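{- Let $T$ be a spiked star with $\alpha(T)\ge3$ and let $G$ be a graph. Then an interesting partition $X_1,\dots,X_{\alpha(T)-1}$ of $V(G)$ is $T$-freeness certifying precisely if either (i) every $G[X_i]$ is the complement of a matching, or (ii) $G[X_i]$ is a clique for every $i>1$, and the vertex set of each connected component of the complement of $G[X_1]$ induces in $G$ the disjoint union of a single vertex and a complete multipartite graph.
   Context: Graphs are finite and simple; $\alpha(\cdot)$ is the stability number. A complement of a matching is a graph whose complement is a matching. "Complete multipartite graph" includes stable sets (complete multipartite with one part). A star is a tree in which all but one vertex are leaves. The spiking of a tree $T'$ is obtained from the disjoint union of $T'$ and a stable set with $|V(T')|$ vertices by adding a perfect matching between $V(T')$ and the stable set; a spiked star is a spiking of a star. An interesting partition of $V(G)$ (with respect to $T$) is a partition $(X_1,\dots,X_{\alpha(T)-1})$ such that $\alpha(G[X_1])\ge\alpha(G[X_j])$ for all $j\ge2$ and each $G[X_i]$ contains either a clique or a stable set of size $|V(T)|$. A $T$-freeness witnessing partition of $G$ is a partition of $V(G)$ into $\alpha(T)-1$ parts $X_1,\dots,X_{\alpha(T)-1}$ such that for every partition $Y_1,\dots,Y_{\alpha(T)-1}$ of $V(T)$ there is an $i$ with $T[Y_i]$ not an induced subgraph of $G[X_i]$. It is $T$-freeness certifying if moreover (i) $\alpha(G[X_1])\ge\alpha(G[X_i])$ for $i\ge2$; (ii) for $i\ge2$, $G[X_i]$ contains a clique of size $|V(T)|$ and $G[X_1]$ contains a clique or a stable set of size $|V(T)|$; (iii) each $G[X_i]$ is $P_4$-free.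 -}

module Defs where

open import Data.Nat using (ℕ; zero; suc; _+_; _≤_)
open import Data.Fin using (Fin; zero; suc; splitAt; _≟_)
open import Data.Bool using (Bool; true; false)
open import Data.Sum using (_⊎_; inj₁; inj₂)
open import Data.Product using (Σ; _×_; _,_; ∃)
open import Data.Empty using (⊥)
open import Relation.Nullary using (¬_; yes; no)
open import Relation.Nullary.Decidable using (⌊_⌋)
open import Relation.Binary.PropositionalEquality using (_≡_; _≢_; refl; sym)

record Graph (n : ℕ) : Set where
  field
    adj    : Fin n → Fin n → Bool
    adj-sym : ∀ u v → adj u v ≡ adj v u
    irrefl : ∀ v → adj v v ≡ false
open Graph public

VSet : ℕ → Set₁
VSet n = Fin n → Set

Full : ∀ {n} → VSet n
Full _ = Data.Unit.⊤ where import Data.Unit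

Injective : ∀ {k n} → (Fin k → Fin n) → Set
Injective f = ∀ i j → f i ≡ f j → i ≡ j

HasClique : ∀ {n} → Graph n → VSet n → ℕ → Set
HasClique {n} G X k =
  Σ (Fin k → Fin n) λ f → Injective f × (∀ i → X (f i)) ×
    (∀ i j → i ≢ j → adj G (f i) (f j) ≡ true)

HasStable : ∀ {n} → Graph n → VSet n → ℕ → Set
HasStable {n} G X k =
  Σ (Fin k → Fin n) λ f → Injective f × (∀ i → X (f i)) ×
    (∀ i j → i ≢ j → adj G (f i) (f j) ≡ false)

IsAlpha : ∀ {n} → Graph n → VSet n → ℕ → Set
IsAlpha G X a = HasStable G X a × (∀ k → HasStable G X k → k ≤ a)

AlphaGE : ∀ {n} → Graph n → VSet n → VSet n → Set
AlphaGE G X Y = ∀ a b → IsAlpha G X a → IsAlpha G Y b → b ≤ a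

IsClique : ∀ {n} → Graph n → VSet n → Set
IsClique G X = ∀ u v → X u → X v → u ≢ v → adj G u v ≡ true

-- G[X] is the complement of a matching: every vertex of X is non-adjacent
-- to at most one other vertex of X.
IsCoMatching : ∀ {n} → Graph n → VSet n → Set
IsCoMatching G X = ∀ u v w → X u → X v → X w → u ≢ v → u ≢ w →
  adj G u v ≡ false → adj G u w ≡ false → v ≡ w

P4Free : ∀ {n} → Graph n → VSet n → Set
P4Free G X = ∀ a b c d → X a → X b → X c → X d →
  a ≢ b → a ≢ c → a ≢ d → b ≢ c → b ≢ d → c ≢ d →
  adj G a b ≡ true → adj G b c ≡ true → adj G c d ≡ true →
  adj G a c ≡ false → adj G b d ≡ false → adj G a d ≡ false → ⊥

-- G[S] is complete multipartite: there is a part-labelling q such that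
-- distinct vertices of S are non-adjacent iff they lie in the same part.
-- (A stable set is the case of one part; the empty graph is allowed.)
IsCompleteMultipartite : ∀ {n} → Graph n → VSet n → Set
IsCompleteMultipartite {n} G S =
  Σ (Fin n → ℕ) λ q → ∀ u v → S u → S v → u ≢ v →
    (adj G u v ≡ false → q u ≡ q v) × (q u ≡ q v → adj G u v ≡ false)

IsK1PlusCompleteMultipartite : ∀ {n} → Graph n → VSet n → Set
IsK1PlusCompleteMultipartite {n} G C =
  Σ (Fin n) λ w → C w × (∀ v → C v → v ≢ w → adj G w v ≡ false) ×
    IsCompleteMultipartite G (λ v → C v × v ≢ w)

data CoReach {n} (G : Graph n) (X : VSet n) (u : Fin n) : Fin n → Set where
  here : X u → CoReach G X u u
  step : ∀ {v w} → CoReach G X u v → X w → v ≢ w → adj G v w ≡ false →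
         CoReach G X u w

CoComponent : ∀ {n} → Graph n → VSet n → Fin n → VSet n
CoComponent G X u v = X v × CoReach G X u v

InducedIn : ∀ {m n} → Graph m → VSet m → Graph n → VSet n → Set
InducedIn {m} {n} T Y G X =
  Σ (Fin m → Fin n) λ f → (∀ u → Y u → X (f u)) ×
    (∀ u v → Y u → Y v → f u ≡ f v → u ≡ v) ×
    (∀ u v → Y u → Y v → u ≢ v → adj T u v ≡ adj G (f u) (f v))

Iso : ∀ {m n} → Graph m → Graph n → Set
Iso {m} {n} G H =
  Σ (Fin m → Fin n) λ f → Σ (Fin n → Fin m) λ g →
    (∀ x → g (f x) ≡ x) × (∀ y → f (g y) ≡ y) ×
    (∀ u v → adj G u v ≡ adj H (f u) (f v))

starAdj : ∀ {k} → Fin (suc k) → Fin (suc k) → Bool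
starAdj zero    zero    = false
starAdj zero    (suc _) = true
starAdj (suc _) zero    = true
starAdj (suc _) (suc _) = false

starSym : ∀ {k} (u v : Fin (suc k)) → starAdj u v ≡ starAdj v u
starSym zero    zero    = refl
starSym zero    (suc _) = refl
starSym (suc _) zero    = refl
starSym (suc _) (suc _) = refl

starIrr : ∀ {k} (v : Fin (suc k)) → starAdj v v ≡ false
starIrr zero    = refl
starIrr (suc _) = refl

Star : (k : ℕ) → Graph (suc k)
Star k = record { adj = starAdj ; adj-sym = starSym ; irrefl = starIrr }

-- Spiking: vertices inj₁ a are the original vertices, inj₂ a the new
-- stable set; inj₁ a — inj₂ a is the perfect matching.
eqb : ∀ {m} → Fin m → Fin m → Bool
eqb a b = ⌊ a ≟ b ⌋

eqbSym : ∀ {m} (a b : Fin m) → eqb a b ≡ eqb b a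
eqbSym a b with a ≟ b | b ≟ a
... | yes _ | yes _ = refl
... | no _  | no _  = refl
... | yes p | no q  = Data.Empty.⊥-elim (q (sym p)) where import Data.Empty
... | no q  | yes p = Data.Empty.⊥-elim (q (sym p)) where import Data.Empty

spAdj : ∀ {m} → Graph m → Fin m ⊎ Fin m → Fin m ⊎ Fin m → Bool
spAdj T (inj₁ a) (inj₁ b) = adj T a b
spAdj T (inj₁ a) (inj₂ b) = eqb a b
spAdj T (inj₂ a) (inj₁ b) = eqb a b
spAdj T (inj₂ a) (inj₂ b) = false

spSym : ∀ {m} (T : Graph m) x y → spAdj T x y ≡ spAdj T y x
spSym T (inj₁ a) (inj₁ b) = adj-sym T a b
spSym T (inj₁ a) (inj₂ b) = eqbSym a b
spSym T (inj₂ a) (inj₁ b) = eqbSym a b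
spSym T (inj₂ a) (inj₂ b) = refl

spIrr : ∀ {m} (T : Graph m) x → spAdj T x x ≡ false
spIrr T (inj₁ a) = irrefl T a
spIrr T (inj₂ a) = refl

Spiking : ∀ {m} → Graph m → Graph (m + m)
Spiking {m} T = record
  { adj    = λ x y → spAdj T (splitAt m x) (splitAt m y)
  ; adj-sym = λ x y → spSym T (splitAt m x) (splitAt m y)
  ; irrefl = λ x → spIrr T (splitAt m x) }

IsSpikedStar : ∀ {n} → Graph n → Set
IsSpikedStar T = Σ ℕ λ k → Iso T (Spiking (Star k))

-- Partitions of V(G) into (suc m) parts, given by a labelling p.
-- Part X_1 of the paper is the part labelled zero.

Part : ∀ {N m} → (Fin N → Fin m) → Fin m → VSet N
Part p i v = p v ≡ i

Interesting : ∀ {n N m} → Graph n → Graph N → (Fin N → Fin (suc m)) → Set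
Interesting {n} T G p =
  (∀ j → j ≢ zero → AlphaGE G (Part p zero) (Part p j)) ×
  (∀ i → HasClique G (Part p i) n ⊎ HasStable G (Part p i) n)

Witnessing : ∀ {n N m} → Graph n → Graph N → (Fin N → Fin (suc m)) → Set
Witnessing {n} {N} {m} T G p =
  ∀ (q : Fin n → Fin (suc m)) →
    ∃ λ i → ¬ InducedIn T (Part q i) G (Part p i)

Certifying : ∀ {n N m} → Graph n → Graph N → (Fin N → Fin (suc m)) → Set
Certifying {n} T G p =
  Witnessing T G p ×
  (∀ j → j ≢ zero → AlphaGE G (Part p zero) (Part p j)) ×
  ((∀ j → j ≢ zero → HasClique G (Part p j) n) ×
   (HasClique G (Part p zero) n ⊎ HasStable G (Part p zero) n)) ×
  (∀ i → P4Free G (Part p i))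

{-# OPTIONS --safe #-}
module Submission where

-- Since α(T) = m + 2, the spiked star T has k = m + 1 leaves, as many as the partition has parts.
--
-- Certifying ⇒ (i) or (ii). A witnessing partition cannot host the spiked P₃ (centre, two leaves and
-- their spikes) split between X₁ and some X_j: the other leaf pairs are edges and go one per
-- remaining part, each of which contains a clique of size |V(T)|. If some X_j (j > 1) is not a
-- clique, it contains P₃ or K₁+K₂, so X₁ contains neither K₁+K₂ nor 3K₁, i.e. X₁ is a co-matching;
-- X₁ then contains a P₃ (it is not a clique, as α(X₁) ≥ α(X_j) ≥ 2), and this in turn makes every
-- such X_j a co-matching. If all X_j are cliques, X₁ contains no 2K₂ and no 2K₁+K₂, and no P₄ by
-- certification. In the complement these are P₄, C₄ and the diamond, and without them every
-- component of the complement of X₁ has a vertex adjacent to all its other vertices, which in turn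
-- form a disjoint union of cliques.
--
-- (i) or (ii) ⇒ certifying. A co-matching cannot host three vertices of T other than the centre,
-- and the pigeonhole principle puts three of these 2k + 1 vertices in one of the k parts. In case
-- (ii), a part j > 1 of a partition of V(T) must be a clique of T, so two vertices of every stable
-- set of size k + 1 fall in part 1; two such stable sets force a P₄, 2K₂ or 2K₁+K₂ in part 1.

open import Defs
open import Data.Nat using (ℕ; zero; suc; _+_; _≤_; _<_; z≤n; s≤s)
import Data.Nat.Properties as ℕ
open import Data.Fin using (Fin; zero; suc; _≟_; toℕ; splitAt; join; _↑ˡ_; _↑ʳ_; punchIn; #_)
  renaming (_<_ to _<ᶠ_)
import Data.Fin.Properties as Fin
open import Data.Bool using (Bool; true; false; if_then_else_)
import Data.Bool as Bool
open import Data.Bool.Properties using (not-¬; ¬-not)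
open import Data.Product using (Σ; ∃; ∃₂; _×_; _,_; proj₁; proj₂; uncurry)
open import Data.Sum using (_⊎_; inj₁; inj₂; [_,_]′)
import Data.Sum as Sum
open import Data.Sum.Properties using (inj₁-injective; inj₂-injective; ≡-dec)
open import Data.Unit using (tt)
open import Data.Empty using (⊥; ⊥-elim)
open import Data.Vec.Functional using (Vector; []; _∷_)
open import Function using (_∘_; id; const)
open import Function.Bundles using (_⇔_; mk⇔)
open import Relation.Nullary using (¬_; yes; no; Dec)
open import Relation.Nullary.Decidable using (_×-dec_; _→-dec_; ¬?; decidable-stable; True; toWitness)
open import Relation.Unary using (Decidable)
open import Relation.Binary.PropositionalEquality

-- Induced embeddings between graphs on arbitrary vertex types

-- InducedIn T Y G X of Defs is adj T [ Y ]⊑ adj G [ X ]; other vertex types are needed for the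
-- spiked star, whose vertices are best described by Fin (suc k) ⊎ Fin (suc k).
IsEmbedding : {V W : Set} → (V → V → Bool) → (V → Set) → (W → W → Bool) → (W → Set) → (V → W) → Set
IsEmbedding E Y F Z f =
  (∀ u → Y u → Z (f u)) ×
  (∀ u v → Y u → Y v → f u ≡ f v → u ≡ v) ×
  (∀ u v → Y u → Y v → u ≢ v → E u v ≡ F (f u) (f v))

_[_]⊑_[_] : {V W : Set} → (V → V → Bool) → (V → Set) → (W → W → Bool) → (W → Set) → Set
_[_]⊑_[_] {V} {W} E Y F Z = Σ (V → W) (IsEmbedding E Y F Z)

module _ {V W U : Set} {E : V → V → Bool} {F : W → W → Bool} {H : U → U → Bool}
         {Y : V → Set} {Z : W → Set} {X : U → Set} where

  ⊑-trans : E [ Y ]⊑ F [ Z ] → F [ Z ]⊑ H [ X ] → E [ Y ]⊑ H [ X ]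
  ⊑-trans (f , f∈ , f-inj , f-adj) (g , g∈ , g-inj , g-adj) =
    g ∘ f ,
    (λ u yu → g∈ (f u) (f∈ u yu)) ,
    (λ u v yu yv e → f-inj u v yu yv (g-inj (f u) (f v) (f∈ u yu) (f∈ v yv) e)) ,
    (λ u v yu yv u≢v → trans (f-adj u v yu yv u≢v)
                             (g-adj (f u) (f v) (f∈ u yu) (f∈ v yv) (u≢v ∘ f-inj u v yu yv)))

record _≅_ {V W : Set} (E : V → V → Bool) (F : W → W → Bool) : Set where
  field
    to      : V → W
    from    : W → V
    from∘to : ∀ u → from (to u) ≡ u
    to∘from : ∀ w → to (from w) ≡ w
    adj-to  : ∀ u v → E u v ≡ F (to u) (to v)

  to-injective : ∀ {u v} → to u ≡ to v → u ≡ v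
  to-injective {u} {v} e = trans (sym (from∘to u)) (trans (cong from e) (from∘to v))

  from-injective : ∀ {w x} → from w ≡ from x → w ≡ x
  from-injective {w} {x} e = trans (sym (to∘from w)) (trans (cong to e) (to∘from x))

  adj-from : ∀ w x → F w x ≡ E (from w) (from x)
  adj-from w x = sym (trans (adj-to (from w) (from x)) (cong₂ F (to∘from w) (to∘from x)))

  from-⊑ : (Y : V → Set) → F [ Y ∘ from ]⊑ E [ Y ]
  from-⊑ Y = from , (λ _ y → y) , (λ w x _ _ → from-injective) , (λ w x _ _ _ → adj-from w x)

open _≅_ public using (to; from)

≅-sym : ∀ {V W : Set} {E : V → V → Bool} {F : W → W → Bool} → E ≅ F → F ≅ E
≅-sym E≅F = record
  { to = from E≅F ; from = to E≅F ; from∘to = _≅_.to∘from E≅F ; to∘from = _≅_.from∘to E≅F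
  ; adj-to = _≅_.adj-from E≅F }

-- Witnessing T G p is WitnessingFor (adj T) G p.
WitnessingFor : ∀ {V : Set} {N k} → (V → V → Bool) → Graph N → (Fin N → Fin k) → Set
WitnessingFor {V} E G p = ∀ (q : V → Fin _) → ∃ λ i → ¬ E [ (λ v → q v ≡ i) ]⊑ adj G [ Part p i ]

≅-witnessing : ∀ {V W : Set} {E : V → V → Bool} {F : W → W → Bool} {N k} (G : Graph N) (p : Fin N → Fin k) →
               E ≅ F → WitnessingFor F G p → WitnessingFor E G p
≅-witnessing G p E≅F witnessing q with i , no-embedding ← witnessing (q ∘ from E≅F) =
  i , λ part⊑G → no-embedding (⊑-trans {H = adj G} {X = Part p i} (_≅_.from-⊑ E≅F (λ v → q v ≡ i)) part⊑G)

-- Small patterns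

◁-adj : ∀ {r} → Vector Bool r → (Fin r → Fin r → Bool) → Fin (suc r) → Fin (suc r) → Bool
◁-adj row A zero    zero    = false
◁-adj row A zero    (suc v) = row v
◁-adj row A (suc u) zero    = row u
◁-adj row A (suc u) (suc v) = A u v

_◁_ : ∀ {r} → Vector Bool r → Graph r → Graph (suc r)
row ◁ H = record { adj = ◁-adj row (adj H) ; adj-sym = symmetric ; irrefl = irreflexive }
  where
  symmetric : ∀ u v → ◁-adj row (adj H) u v ≡ ◁-adj row (adj H) v u
  symmetric zero    zero    = refl
  symmetric zero    (suc v) = refl
  symmetric (suc u) zero    = refl
  symmetric (suc u) (suc v) = adj-sym H u v
  irreflexive : ∀ v → ◁-adj row (adj H) v v ≡ false
  irreflexive zero    = refl
  irreflexive (suc v) = irrefl H v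

infixr 5 _◁_

∅ : Graph 0
∅ = record { adj = λ () ; adj-sym = λ () ; irrefl = λ () }

K₁ : Graph 1
K₁ = [] ◁ ∅

K₂ 2K₁ : Graph 2
K₂  = (true ∷ []) ◁ K₁
2K₁ = (false ∷ []) ◁ K₁

P₃ K₁+K₂ 3K₁ : Graph 3
P₃    = (true ∷ false ∷ []) ◁ K₂
K₁+K₂ = (false ∷ false ∷ []) ◁ K₂
3K₁   = (false ∷ false ∷ []) ◁ 2K₁

2K₂ 2K₁+K₂ P₄ : Graph 4
2K₂    = (true ∷ false ∷ false ∷ []) ◁ K₁+K₂
2K₁+K₂ = (false ∷ false ∷ false ∷ []) ◁ K₁+K₂
P₄     = (true ∷ false ∷ false ∷ []) ◁ P₃

_[_]∋_ : ∀ {V : Set} {r} → (V → V → Bool) → (V → Set) → Graph r → Set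
E [ Y ]∋ H = adj H [ Full ]⊑ E [ Y ]

module Occurrences {V : Set} (E : V → V → Bool) (E-sym : ∀ u v → E u v ≡ E v u)
                   (E-irrefl : ∀ v → E v v ≡ false) (Y : V → Set) where

  adjacent⇒≢ : ∀ {a b} → E a b ≡ true → a ≢ b
  adjacent⇒≢ {a} ab refl = not-¬ ab (E-irrefl a)

  separated : ∀ {a b c} → E a c ≡ true → E b c ≡ false → a ≢ b
  separated ac bc refl = not-¬ ac bc

  swap-adj : ∀ {a b x} → E a b ≡ x → E b a ≡ x
  swap-adj {a} {b} ab = trans (E-sym b a) ab

  ◁-occurs : ∀ {r} (H : Graph r) (row : Vector Bool r) {f : Fin r → V} {x : V} →
             IsEmbedding (adj H) Full E Y f → Y x → (∀ a → x ≢ f a) → (∀ a → E x (f a) ≡ row a) →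
             IsEmbedding (adj (row ◁ H)) Full E Y (x ∷ f)
  ◁-occurs H row {f} {x} (f∈ , f-inj , f-adj) yx fresh row-ok = x∷f∈ , x∷f-inj , x∷f-adj
    where
    x∷f∈ : ∀ a → Full a → Y ((x ∷ f) a)
    x∷f∈ zero    _ = yx
    x∷f∈ (suc a) _ = f∈ a tt
    x∷f-inj : ∀ a b → Full a → Full b → (x ∷ f) a ≡ (x ∷ f) b → a ≡ b
    x∷f-inj zero    zero    _ _ _ = refl
    x∷f-inj zero    (suc b) _ _ e = ⊥-elim (fresh b e)
    x∷f-inj (suc a) zero    _ _ e = ⊥-elim (fresh a (sym e))
    x∷f-inj (suc a) (suc b) _ _ e = cong suc (f-inj a b tt tt e)
    x∷f-adj : ∀ a b → Full a → Full b → a ≢ b → adj (row ◁ H) a b ≡ E ((x ∷ f) a) ((x ∷ f) b)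
    x∷f-adj zero    zero    _ _ a≢b = ⊥-elim (a≢b refl)
    x∷f-adj zero    (suc b) _ _ _   = sym (row-ok b)
    x∷f-adj (suc a) zero    _ _ _   = trans (sym (row-ok a)) (E-sym x (f a))
    x∷f-adj (suc a) (suc b) _ _ a≢b = f-adj a b tt tt (a≢b ∘ cong suc)

  private
    K₁-occurs : ∀ {a} → Y a → IsEmbedding (adj K₁) Full E Y (a ∷ [])
    K₁-occurs ya = ◁-occurs ∅ [] ((λ ()) , (λ ()) , (λ ())) ya (λ ()) (λ ())

    K₂-occurs : ∀ {a b} → Y a → Y b → E a b ≡ true → IsEmbedding (adj K₂) Full E Y (a ∷ b ∷ [])
    K₂-occurs ya yb ab =
      ◁-occurs K₁ (true ∷ []) (K₁-occurs yb) ya (λ { zero → adjacent⇒≢ ab }) (λ { zero → ab })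

    2K₁-occurs : ∀ {a b} → Y a → Y b → a ≢ b → E a b ≡ false →
                 IsEmbedding (adj 2K₁) Full E Y (a ∷ b ∷ [])
    2K₁-occurs ya yb a≢b ab = ◁-occurs K₁ (false ∷ []) (K₁-occurs yb) ya (λ { zero → a≢b }) (λ { zero → ab })

    P₃-occurs : ∀ {a b c} → Y a → Y b → Y c → a ≢ c → E a b ≡ true → E a c ≡ false → E b c ≡ true →
                IsEmbedding (adj P₃) Full E Y (a ∷ b ∷ c ∷ [])
    P₃-occurs ya yb yc a≢c ab ac bc =
      ◁-occurs K₂ (true ∷ false ∷ []) (K₂-occurs yb yc bc) ya
        (λ { zero → adjacent⇒≢ ab ; (suc zero) → a≢c })
        (λ { zero → ab ; (suc zero) → ac })

    K₁+K₂-occurs : ∀ {a b c} → Y a → Y b → Y c → E a b ≡ false → E a c ≡ false → E b c ≡ true →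
                   IsEmbedding (adj K₁+K₂) Full E Y (a ∷ b ∷ c ∷ [])
    K₁+K₂-occurs ya yb yc ab ac bc =
      ◁-occurs K₂ (false ∷ false ∷ []) (K₂-occurs yb yc bc) ya
        (λ { zero → separated bc ac ∘ sym ; (suc zero) → separated (swap-adj bc) ab ∘ sym })
        (λ { zero → ab ; (suc zero) → ac })

  -- The vertices are listed in the order of the pattern; distinctness is asked for only where the
  -- adjacencies do not imply it.

  K₂-in : ∀ {a b} → Y a → Y b → E a b ≡ true → E [ Y ]∋ K₂
  K₂-in ya yb ab = _ , K₂-occurs ya yb ab

  P₃-in : ∀ {a b c} → Y a → Y b → Y c → a ≢ c →
          E a b ≡ true → E a c ≡ false → E b c ≡ true → E [ Y ]∋ P₃
  P₃-in ya yb yc a≢c ab ac bc = _ , P₃-occurs ya yb yc a≢c ab ac bc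

  K₁+K₂-in : ∀ {a b c} → Y a → Y b → Y c →
             E a b ≡ false → E a c ≡ false → E b c ≡ true → E [ Y ]∋ K₁+K₂
  K₁+K₂-in ya yb yc ab ac bc = _ , K₁+K₂-occurs ya yb yc ab ac bc

  3K₁-in : ∀ {a b c} → Y a → Y b → Y c → a ≢ b → a ≢ c → b ≢ c →
           E a b ≡ false → E a c ≡ false → E b c ≡ false → E [ Y ]∋ 3K₁
  3K₁-in ya yb yc a≢b a≢c b≢c ab ac bc =
    _ , ◁-occurs 2K₁ (false ∷ false ∷ []) (2K₁-occurs yb yc b≢c bc) ya
          (λ { zero → a≢b ; (suc zero) → a≢c })
          (λ { zero → ab ; (suc zero) → ac })

  2K₂-in : ∀ {a b c d} → Y a → Y b → Y c → Y d →
           E a b ≡ true → E a c ≡ false → E a d ≡ false → E b c ≡ false → E b d ≡ false → E c d ≡ true →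
           E [ Y ]∋ 2K₂
  2K₂-in ya yb yc yd ab ac ad bc bd cd =
    _ , ◁-occurs K₁+K₂ (true ∷ false ∷ false ∷ []) (K₁+K₂-occurs yb yc yd bc bd cd) ya
          (λ { zero → adjacent⇒≢ ab ; (suc zero) → separated ab (swap-adj bc)
             ; (suc (suc zero)) → separated ab (swap-adj bd) })
          (λ { zero → ab ; (suc zero) → ac ; (suc (suc zero)) → ad })

  2K₁+K₂-in : ∀ {a b c d} → Y a → Y b → Y c → Y d → a ≢ b →
              E a b ≡ false → E a c ≡ false → E a d ≡ false → E b c ≡ false → E b d ≡ false →
              E c d ≡ true → E [ Y ]∋ 2K₁+K₂
  2K₁+K₂-in ya yb yc yd a≢b ab ac ad bc bd cd =
    _ , ◁-occurs K₁+K₂ (false ∷ false ∷ false ∷ []) (K₁+K₂-occurs yb yc yd bc bd cd) ya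
          (λ { zero → a≢b ; (suc zero) → separated cd ad ∘ sym
             ; (suc (suc zero)) → separated (swap-adj cd) ac ∘ sym })
          (λ { zero → ab ; (suc zero) → ac ; (suc (suc zero)) → ad })

  P₄-in : ∀ {a b c d} → Y a → Y b → Y c → Y d →
          E a b ≡ true → E a c ≡ false → E a d ≡ false → E b c ≡ true → E b d ≡ false → E c d ≡ true →
          E [ Y ]∋ P₄
  P₄-in ya yb yc yd ab ac ad bc bd cd =
    _ , ◁-occurs P₃ (true ∷ false ∷ false ∷ [])
          (P₃-occurs yb yc yd (separated (swap-adj ab) (swap-adj ad)) bc bd cd) ya
          (λ { zero → adjacent⇒≢ ab ; (suc zero) → separated cd ad ∘ sym
             ; (suc (suc zero)) → separated ab (swap-adj bd) })
          (λ { zero → ab ; (suc zero) → ac ; (suc (suc zero)) → ad })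

-- Counting on finite sets

join-injective : ∀ m n {x y : Fin m ⊎ Fin n} → join m n x ≡ join m n y → x ≡ y
join-injective m n {x} {y} e =
  trans (sym (Fin.splitAt-join m n x)) (trans (cong (splitAt m) e) (Fin.splitAt-join m n y))

splitAt-injective : ∀ m n {s t : Fin (m + n)} → splitAt m s ≡ splitAt m t → s ≡ t
splitAt-injective m n {s} {t} e =
  trans (sym (Fin.join-splitAt m n s)) (trans (cong (join m n) e) (Fin.join-splitAt m n t))

no-injection-into-pair : ∀ {n} {A : Set} {s t : A} → 2 < n → (f : Fin n → A) →
                         (∀ i j → f i ≡ f j → i ≡ j) → (∀ i → f i ≡ s ⊎ f i ≡ t) → ⊥
no-injection-into-pair {s = s} {t} 2<n f f-inj choice
  with i , j , i<j , same-side ← Fin.pigeonhole 2<n ([ const zero , const (suc zero) ]′ ∘ choice) =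
  ⊥-elim (Fin.<-irrefl (f-inj i j (coincide (choice i) (choice j) same-side)) i<j)
  where
  coincide : ∀ {a b} (p : a ≡ s ⊎ a ≡ t) (q : b ≡ s ⊎ b ≡ t) →
             [ const zero , const (suc zero) ]′ p ≡ [ const zero , const (suc zero) ]′ q → a ≡ b
  coincide (inj₁ a≡s) (inj₁ b≡s) _ = trans a≡s (sym b≡s)
  coincide (inj₂ a≡t) (inj₂ b≡t) _ = trans a≡t (sym b≡t)
  coincide (inj₁ _)   (inj₂ _)   ()
  coincide (inj₂ _)   (inj₁ _)   ()

outside-two : ∀ {n N} → 2 < n → (f : Fin n → Fin N) → (∀ i j → f i ≡ f j → i ≡ j) →
              ∀ s t → ∃ λ i → f i ≢ s × f i ≢ t
outside-two 2<n f f-inj s t with Fin.any? (λ i → ¬? (f i ≟ s) ×-dec ¬? (f i ≟ t))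
... | yes found = found
... | no none   = ⊥-elim (no-injection-into-pair 2<n f f-inj choice)
  where
  choice : ∀ i → f i ≡ s ⊎ f i ≡ t
  choice i with f i ≟ s
  ... | yes fi≡s = inj₁ fi≡s
  ... | no fi≢s  = inj₂ (decidable-stable (f i ≟ t) λ fi≢t → none (i , fi≢s , fi≢t))

-- Tag every point with its value and with whether that value already occurred at an earlier point:
-- two of K + K + 1 points share a tag, and the later of them has the same value as the earlier one
-- and as a third point before it.
module _ {K M : ℕ} (f : Fin M → Fin K) where

  private
    Repeated : Fin M → Set
    Repeated t = ∃ λ s → s <ᶠ t × f s ≡ f t

    repeated? : Decidable Repeated
    repeated? t = Fin.any? λ s → (s Fin.<? t) ×-dec (f s ≟ f t)

    tag : Fin M → Fin K ⊎ Fin K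
    tag t with repeated? t
    ... | yes _ = inj₂ (f t)
    ... | no _  = inj₁ (f t)

    collision : ∀ {i j} → i <ᶠ j → tag i ≡ tag j → ∃ λ s → s <ᶠ i × f s ≡ f i × f i ≡ f j
    collision {i} {j} i<j same with repeated? i | repeated? j
    ... | yes (s , s<i , fs≡fi) | yes _ = s , s<i , fs≡fi , inj₂-injective same
    ... | no _  | no ¬repeated-j        = ⊥-elim (¬repeated-j (i , i<j , inj₁-injective same))
    ... | yes _ | no _ with () ← same
    ... | no _  | yes _ with () ← same

  pigeonhole₃ : K + K < M → ∃ λ s → ∃₂ λ i j → s <ᶠ i × i <ᶠ j × f s ≡ f i × f i ≡ f j
  pigeonhole₃ K+K<M
    with i , j , i<j , same ← Fin.pigeonhole K+K<M (join K K ∘ tag)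
    with s , s<i , fs≡fi , fi≡fj ← collision i<j (join-injective K K same) =
    s , i , j , s<i , i<j , fs≡fi , fi≡fj

-- The value is n when nothing satisfies P.
least : ∀ {n} {P : Fin n → Set} → Decidable P → ℕ
least {zero}  P? = zero
least {suc n} P? with P? zero
... | yes _ = zero
... | no _  = suc (least (P? ∘ suc))

least-cong : ∀ {n} {P Q : Fin n → Set} (P? : Decidable P) (Q? : Decidable Q) →
             (∀ i → P i → Q i) → (∀ i → Q i → P i) → least P? ≡ least Q?
least-cong {zero}  P? Q? P⇒Q Q⇒P = refl
least-cong {suc n} P? Q? P⇒Q Q⇒P with P? zero | Q? zero
... | yes _ | yes _ = refl
... | yes p | no ¬q = ⊥-elim (¬q (P⇒Q zero p))
... | no ¬p | yes q = ⊥-elim (¬p (Q⇒P zero q))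
... | no _  | no _  = cong suc (least-cong (P? ∘ suc) (Q? ∘ suc) (P⇒Q ∘ suc) (Q⇒P ∘ suc))

least-attained : ∀ {n} {P : Fin n → Set} (P? : Decidable P) {i} → P i → ∃ λ j → P j × toℕ j ≡ least P?
least-attained {suc n} P? {i} p with P? zero | i
... | yes p₀ | _     = zero , p₀ , refl
... | no ¬p₀ | zero  = ⊥-elim (¬p₀ p)
... | no ¬p₀ | suc i with j , pj , j≡least ← least-attained (P? ∘ suc) {i} p = suc j , pj , cong suc j≡least

-- Cliques, co-matchings and stability numbers

module _ {N : ℕ} (G : Graph N) where

  NonEdge : VSet N → Set
  NonEdge X = ∃₂ λ u v → X u × X v × u ≢ v × adj G u v ≡ false

  nonEdge? : {X : VSet N} → Decidable X → Dec (NonEdge X)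
  nonEdge? X? = Fin.any? λ u → Fin.any? λ v → X? u ×-dec X? v ×-dec ¬? (u ≟ v) ×-dec (adj G u v Bool.≟ false)

  no-nonEdge⇒clique : {X : VSet N} → ¬ NonEdge X → IsClique G X
  no-nonEdge⇒clique no-nonEdge u v xu xv u≢v = ¬-not λ uv → no-nonEdge (u , v , xu , xv , u≢v , uv)

  clique⇒no-nonEdge : {X : VSet N} → IsClique G X → ¬ NonEdge X
  clique⇒no-nonEdge clique (u , v , xu , xv , u≢v , uv) = not-¬ (clique u v xu xv u≢v) uv

  clique⇒coMatching : {X : VSet N} → IsClique G X → IsCoMatching G X
  clique⇒coMatching clique u v _ xu xv _ u≢v _ uv _ = ⊥-elim (clique⇒no-nonEdge clique (u , v , xu , xv , u≢v , uv))

  module _ {X : VSet N} where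
    open Occurrences (adj G) (adj-sym G) (irrefl G) X

    clique⇒P4Free : IsClique G X → P4Free G X
    clique⇒P4Free clique a _ c _ xa _ xc _ _ a≢c _ _ _ _ _ _ _ ac _ _ = not-¬ (clique a c xa xc a≢c) ac

    coMatching⇒P4Free : IsCoMatching G X → P4Free G X
    coMatching⇒P4Free coMatching a _ c d xa _ xc xd _ a≢c a≢d _ _ c≢d _ _ _ ac _ ad =
      c≢d (coMatching a c d xa xc xd a≢c a≢d ac ad)

    P4Free⇒P₄-free : P4Free G X → ¬ adj G [ X ]∋ P₄
    P4Free⇒P₄-free P4-free (f , f∈ , f-inj , f-adj) =
      P4-free (f zero) (f (suc zero)) (f (suc (suc zero))) (f (suc (suc (suc zero))))
        (f∈ _ tt) (f∈ _ tt) (f∈ _ tt) (f∈ _ tt)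
        (apart λ ()) (apart λ ()) (apart λ ()) (apart λ ()) (apart λ ()) (apart λ ())
        (edge λ ()) (edge λ ()) (edge λ ()) (edge λ ()) (edge λ ()) (edge λ ())
      where
      apart : ∀ {i j} → i ≢ j → f i ≢ f j
      apart i≢j = i≢j ∘ f-inj _ _ tt tt
      edge : ∀ {i j} → i ≢ j → adj G (f i) (f j) ≡ adj P₄ i j
      edge i≢j = sym (f-adj _ _ tt tt i≢j)

    P₄-free⇒P4Free : ¬ adj G [ X ]∋ P₄ → P4Free G X
    P₄-free⇒P4Free P₄-free a b c d xa xb xc xd _ _ _ _ _ _ ab bc cd ac bd ad =
      P₄-free (P₄-in xa xb xc xd ab ac ad bc bd cd)

    clique-vertex : ∀ {n} → 0 < n → HasClique G X n → ∃ X
    clique-vertex (s≤s _) (f , _ , f∈ , _) = f zero , f∈ zero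

    clique-K₂ : ∀ {n} → 1 < n → HasClique G X n → adj G [ X ]∋ K₂
    clique-K₂ (s≤s (s≤s _)) (f , _ , f∈ , f-adj) = K₂-in (f∈ zero) (f∈ (suc zero)) (f-adj _ _ (λ ()))

    clique-no-stable : IsClique G X → ∀ {n} → 1 < n → ¬ HasStable G X n
    clique-no-stable clique (s≤s (s≤s _)) (f , f-inj , f∈ , f-stable) =
      not-¬ (clique _ _ (f∈ zero) (f∈ (suc zero)) ((λ ()) ∘ f-inj _ _)) (f-stable _ _ (λ ()))

    coMatching-no-stable : IsCoMatching G X → ∀ {n} → 2 < n → ¬ HasStable G X n
    coMatching-no-stable coMatching (s≤s (s≤s (s≤s _))) (f , f-inj , f∈ , f-stable) =
      Fin.0≢1+n (Fin.suc-injective (f-inj (suc zero) (suc (suc zero))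
        (coMatching (f zero) _ _ (f∈ _) (f∈ _) (f∈ _) ((λ ()) ∘ f-inj _ _) ((λ ()) ∘ f-inj _ _)
                    (f-stable _ _ (λ ())) (f-stable _ _ (λ ())))))

    coMatching-if-free : ¬ adj G [ X ]∋ K₁+K₂ → ¬ adj G [ X ]∋ 3K₁ → IsCoMatching G X
    coMatching-if-free no-K₁+K₂ no-3K₁ u v w xu xv xw u≢v u≢w uv uw with v ≟ w | adj G v w in vw
    ... | yes v≡w | _     = v≡w
    ... | no v≢w  | true  = ⊥-elim (no-K₁+K₂ (K₁+K₂-in xu xv xw uv uw vw))
    ... | no v≢w  | false = ⊥-elim (no-3K₁ (3K₁-in xu xv xw u≢v u≢w v≢w uv uw vw))

    adjacent-in-coMatching : IsCoMatching G X → ∀ {s t w} → X s → X t → X w → s ≢ t → s ≢ w → t ≢ w →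
                             adj G s t ≡ false → adj G s w ≡ true
    adjacent-in-coMatching coMatching {s} {t} {w} xs xt xw s≢t s≢w t≢w st with adj G s w in sw
    ... | true  = refl
    ... | false = ⊥-elim (t≢w (coMatching s t w xs xt xw s≢t s≢w st sw))

    module _ {n : ℕ} (2<n : 2 < n) (clique : HasClique G X n) where

      private
        f : Fin n → Fin N
        f = proj₁ clique
        f-inj : ∀ i j → f i ≡ f j → i ≡ j
        f-inj = proj₁ (proj₂ clique)
        f∈ : ∀ i → X (f i)
        f∈ = proj₁ (proj₂ (proj₂ clique))
        f-adj : ∀ {i j} → f i ≢ f j → adj G (f i) (f j) ≡ true
        f-adj fi≢fj = proj₂ (proj₂ (proj₂ clique)) _ _ (fi≢fj ∘ cong f)

      P₃-or-K₁+K₂-beside : ∀ {x} i → X x → f i ≢ x → adj G x (f i) ≡ false →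
                           adj G [ X ]∋ P₃ ⊎ adj G [ X ]∋ K₁+K₂
      P₃-or-K₁+K₂-beside {x} i xx fi≢x xi with j , fj≢fi , fj≢x ← outside-two 2<n f f-inj (f i) x
                                         with adj G x (f j) in xj
      ... | true  = inj₁ (P₃-in xx (f∈ j) (f∈ i) (fi≢x ∘ sym) xj xi (f-adj fj≢fi))
      ... | false = inj₂ (K₁+K₂-in xx (f∈ j) (f∈ i) xj xi (f-adj fj≢fi))

      P₃-or-K₁+K₂ : NonEdge X → adj G [ X ]∋ P₃ ⊎ adj G [ X ]∋ K₁+K₂
      P₃-or-K₁+K₂ (u , v , xu , xv , u≢v , uv) with i , fi≢u , fi≢v ← outside-two 2<n f f-inj u v
                                               with adj G u (f i) in ui | adj G v (f i) in vi
      ... | true  | true  = inj₁ (P₃-in xu (f∈ i) xv u≢v ui uv (swap-adj vi))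
      ... | false | _     = P₃-or-K₁+K₂-beside i xu fi≢u ui
      ... | true  | false = P₃-or-K₁+K₂-beside i xv fi≢v vi

      coMatching-P₃ : IsCoMatching G X → NonEdge X → adj G [ X ]∋ P₃
      coMatching-P₃ coMatching (s , t , xs , xt , s≢t , st) with i , fi≢s , fi≢t ← outside-two 2<n f f-inj s t =
        P₃-in xs (f∈ i) xt s≢t
          (adjacent-in-coMatching coMatching xs xt (f∈ i) s≢t (fi≢s ∘ sym) (fi≢t ∘ sym) st)
          st
          (swap-adj (adjacent-in-coMatching coMatching xt xs (f∈ i) (s≢t ∘ sym) (fi≢t ∘ sym) (fi≢s ∘ sym)
                                            (swap-adj st)))

    empty-stable : HasStable G X 0
    empty-stable = (λ ()) , (λ ()) , (λ ()) , (λ ())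

    stable-pair : ∀ {u v} → X u → X v → u ≢ v → adj G u v ≡ false → HasStable G X 2
    stable-pair {u} {v} xu xv u≢v uv = u ∷ v ∷ [] , pair-inj , pair∈ , pair-stable
      where
      pair-inj : ∀ i j → (u ∷ v ∷ []) i ≡ (u ∷ v ∷ []) j → i ≡ j
      pair-inj zero       zero       _ = refl
      pair-inj zero       (suc zero) e = ⊥-elim (u≢v e)
      pair-inj (suc zero) zero       e = ⊥-elim (u≢v (sym e))
      pair-inj (suc zero) (suc zero) _ = refl
      pair∈ : ∀ i → X ((u ∷ v ∷ []) i)
      pair∈ zero       = xu
      pair∈ (suc zero) = xv
      pair-stable : ∀ i j → i ≢ j → adj G ((u ∷ v ∷ []) i) ((u ∷ v ∷ []) j) ≡ false
      pair-stable zero       zero       i≢j = ⊥-elim (i≢j refl)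
      pair-stable zero       (suc zero) _   = uv
      pair-stable (suc zero) zero       _   = swap-adj uv
      pair-stable (suc zero) (suc zero) i≢j = ⊥-elim (i≢j refl)

    stable-size≤ : ∀ {k} → HasStable G X k → k ≤ N
    stable-size≤ (f , f-inj , _) = Fin.injective⇒≤ (f-inj _ _)

    -- Without deciding HasStable only the double negation is available, which suffices below.
    alpha-exists : ¬ ¬ ∃ (IsAlpha G X)
    alpha-exists no-alpha = search N empty-stable (ℕ.m≤n+m N 0)
      where
      search : ∀ d {b} → HasStable G X b → N ≤ b + d → ⊥
      search zero    {b} stable-b N≤b+0 =
        no-alpha (b , stable-b , λ k stable-k →
          ℕ.≤-trans (stable-size≤ stable-k) (subst (N ≤_) (ℕ.+-identityʳ b) N≤b+0))
      search (suc d) {b} stable-b N≤b+1+d = no-alpha (b , stable-b , maximal)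
        where
        maximal : ∀ k → HasStable G X k → k ≤ b
        maximal k stable-k with k ℕ.≤? b
        ... | yes k≤b = k≤b
        ... | no k≰b  = ⊥-elim (search d stable-k (ℕ.≤-trans N≤b+1+d b+1+d≤k+d))
          where
          b+1+d≤k+d : b + suc d ≤ k + d
          b+1+d≤k+d = subst (_≤ k + d) (sym (ℕ.+-suc b d)) (ℕ.+-monoˡ-≤ d (ℕ.≰⇒> k≰b))

    clique-alpha : ∀ {w} → IsClique G X → X w → IsAlpha G X 1
    clique-alpha {w} clique xw = singleton , at-most-one
      where
      singleton : HasStable G X 1
      singleton = const w , (λ { zero zero _ → refl }) , const xw , (λ { zero zero 0≢0 → ⊥-elim (0≢0 refl) })
      at-most-one : ∀ k → HasStable G X k → k ≤ 1
      at-most-one k stable-k with k ℕ.≤? 1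
      ... | yes k≤1 = k≤1
      ... | no k≰1  = ⊥-elim (clique-no-stable clique (ℕ.≰⇒> k≰1) stable-k)

  alphaGE-clique : ∀ {X Y : VSet N} {w} → AlphaGE G X Y → IsClique G X → X w → IsClique G Y
  alphaGE-clique {Y = Y} X≥Y X-clique xw u v yu yv u≢v = ¬-not λ uv → alpha-exists {Y} λ (b , αY) →
    ℕ.<⇒≱ (proj₂ αY 2 (stable-pair yu yv u≢v uv)) (X≥Y 1 b (clique-alpha X-clique xw) αY)

-- Co-components that are K₁ plus a complete multipartite graph

module _ {N : ℕ} (G : Graph N) where

  NonadjacencyTransitive : VSet N → Set
  NonadjacencyTransitive S = ∀ {u v w} → S u → S v → S w →
                             adj G u v ≡ false → adj G v w ≡ false → adj G u w ≡ false

  completeMultipartite-⊆ : ∀ {S S′ : VSet N} → (∀ v → S′ v → S v) →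
                           IsCompleteMultipartite G S → IsCompleteMultipartite G S′
  completeMultipartite-⊆ S′⊆S (label , same-part) =
    label , λ u v s′u s′v → same-part u v (S′⊆S u s′u) (S′⊆S v s′v)

  -- Non-adjacency is then an equivalence relation on S; a vertex is labelled by the least member
  -- of its class.
  nonadjacencyTransitive⇒completeMultipartite : ∀ {S : VSet N} → Decidable S →
    NonadjacencyTransitive S → IsCompleteMultipartite G S
  nonadjacencyTransitive⇒completeMultipartite {S} S? transitive =
    label , λ u v su sv _ → same-label su sv , nonadjacent su sv
    where
    class? : ∀ u → Decidable (λ z → S z × adj G u z ≡ false)
    class? u z = S? z ×-dec (adj G u z Bool.≟ false)
    label : Fin N → ℕ
    label u = least (class? u)
    swap≁ : ∀ {u v} → adj G u v ≡ false → adj G v u ≡ false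
    swap≁ {u} {v} uv = trans (adj-sym G v u) uv
    same-label : ∀ {u v} → S u → S v → adj G u v ≡ false → label u ≡ label v
    same-label {u} {v} su sv uv =
      least-cong (class? u) (class? v) (λ z (sz , uz) → sz , transitive sv su sz (swap≁ uv) uz)
                                       (λ z (sz , vz) → sz , transitive su sv sz uv vz)
    nonadjacent : ∀ {u v} → S u → S v → label u ≡ label v → adj G u v ≡ false
    nonadjacent {u} {v} su sv labels≡
      with j , (sj , uj) , j≡ ← least-attained (class? u) (su , irrefl G u)
         | k , (sk , vk) , k≡ ← least-attained (class? v) (sv , irrefl G v)
      with refl ← Fin.toℕ-injective (trans j≡ (trans labels≡ (sym k≡))) = transitive su sj sv uj (swap≁ vk)

module _ {N : ℕ} {G : Graph N} {Z : VSet N} where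
  open Occurrences (adj G) (adj-sym G) (irrefl G) Z

  coReach-in : ∀ {u v} → CoReach G Z u v → Z v
  coReach-in (here zu)       = zu
  coReach-in (step _ zv _ _) = zv

  coReach-extend : ∀ {u v w} → CoReach G Z u v → Z w → adj G v w ≡ false → CoReach G Z u w
  coReach-extend {v = v} {w} r zw vw with v ≟ w
  ... | yes refl = r
  ... | no v≢w   = step r zw v≢w vw

  coNeighbour-in : ∀ {u v} → Z u → Z v → adj G u v ≡ false → CoComponent G Z u v
  coNeighbour-in zu zv uv = zv , coReach-extend (here zu) zv uv

  module K₁+CM {C : VSet N} (decomposition : IsK1PlusCompleteMultipartite G C) where

    isolated-vertex : Fin N
    isolated-vertex = proj₁ decomposition

    private
      isolated : ∀ v → C v → v ≢ isolated-vertex → adj G isolated-vertex v ≡ false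
      isolated = proj₁ (proj₂ (proj₂ decomposition))
      label : Fin N → ℕ
      label = proj₁ (proj₂ (proj₂ (proj₂ decomposition)))
      same-part : ∀ u v → C u × u ≢ isolated-vertex → C v × v ≢ isolated-vertex → u ≢ v →
                  (adj G u v ≡ false → label u ≡ label v) × (label u ≡ label v → adj G u v ≡ false)
      same-part = proj₂ (proj₂ (proj₂ (proj₂ decomposition)))

    has-neighbour⇒≢isolated : ∀ {x y} → C y → adj G x y ≡ true → x ≢ isolated-vertex
    has-neighbour⇒≢isolated cy xy refl = not-¬ xy (isolated _ cy (adjacent⇒≢ xy ∘ sym))

    only-isolated-misses-edges : ∀ {x y z} → C x → C y → C z →
                                 adj G x y ≡ false → adj G x z ≡ false → adj G y z ≡ true → x ≡ isolated-vertex
    only-isolated-misses-edges {x} {y} {z} cx cy cz xy xz yz with x ≟ isolated-vertex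
    ... | yes x≡w = x≡w
    ... | no x≢w  = ⊥-elim (not-¬ yz (proj₂ (same-part y z (cy , y≢w) (cz , z≢w) (adjacent⇒≢ yz))
                                             (trans (sym label-xy) label-xz)))
      where
      y≢w : y ≢ isolated-vertex
      y≢w = has-neighbour⇒≢isolated cz yz
      z≢w : z ≢ isolated-vertex
      z≢w = has-neighbour⇒≢isolated cy (swap-adj yz)
      label-xy : label x ≡ label y
      label-xy = proj₁ (same-part x y (cx , x≢w) (cy , y≢w) (separated yz xz ∘ sym)) xy
      label-xz : label x ≡ label z
      label-xz = proj₁ (same-part x z (cx , x≢w) (cz , z≢w) (separated (swap-adj yz) xy ∘ sym)) xz

  module _ (K₁+CM-components : ∀ u → Z u → IsK1PlusCompleteMultipartite G (CoComponent G Z u)) where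

    K₁+CM⇒P₄-free : ¬ adj G [ Z ]∋ P₄
    K₁+CM⇒P₄-free (f , f∈ , _ , f-adj) =
      has-neighbour⇒≢isolated c₁ (edge λ ())
        (only-isolated-misses-edges c₀ c₂ c₃ (edge λ ()) (edge λ ()) (edge λ ()))
      where
      open K₁+CM (K₁+CM-components (f zero) (f∈ zero tt))
      edge : ∀ {i j} → i ≢ j → adj G (f i) (f j) ≡ adj P₄ i j
      edge i≢j = sym (f-adj _ _ tt tt i≢j)
      c₀ : CoComponent G Z (f zero) (f zero)
      c₁ : CoComponent G Z (f zero) (f (suc zero))
      c₂ : CoComponent G Z (f zero) (f (suc (suc zero)))
      c₃ : CoComponent G Z (f zero) (f (suc (suc (suc zero))))
      c₀ = f∈ zero tt , here (f∈ zero tt)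
      c₂ = coNeighbour-in (f∈ zero tt) (f∈ (suc (suc zero)) tt) (edge λ ())
      c₃ = coNeighbour-in (f∈ zero tt) (f∈ (suc (suc (suc zero))) tt) (edge λ ())
      c₁ = f∈ (suc zero) tt , coReach-extend (proj₂ c₃) (f∈ (suc zero) tt) (edge λ ())

    K₁+CM⇒2K₂-free : ¬ adj G [ Z ]∋ 2K₂
    K₁+CM⇒2K₂-free (f , f∈ , _ , f-adj) =
      has-neighbour⇒≢isolated c₁ (edge λ ())
        (only-isolated-misses-edges c₀ c₂ c₃ (edge λ ()) (edge λ ()) (edge λ ()))
      where
      open K₁+CM (K₁+CM-components (f zero) (f∈ zero tt))
      edge : ∀ {i j} → i ≢ j → adj G (f i) (f j) ≡ adj 2K₂ i j
      edge i≢j = sym (f-adj _ _ tt tt i≢j)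
      c₀ : CoComponent G Z (f zero) (f zero)
      c₁ : CoComponent G Z (f zero) (f (suc zero))
      c₂ : CoComponent G Z (f zero) (f (suc (suc zero)))
      c₃ : CoComponent G Z (f zero) (f (suc (suc (suc zero))))
      c₀ = f∈ zero tt , here (f∈ zero tt)
      c₂ = coNeighbour-in (f∈ zero tt) (f∈ (suc (suc zero)) tt) (edge λ ())
      c₃ = coNeighbour-in (f∈ zero tt) (f∈ (suc (suc (suc zero))) tt) (edge λ ())
      c₁ = f∈ (suc zero) tt , coReach-extend (proj₂ c₂) (f∈ (suc zero) tt) (edge λ ())

    K₁+CM⇒2K₁+K₂-free : ¬ adj G [ Z ]∋ 2K₁+K₂
    K₁+CM⇒2K₁+K₂-free (f , f∈ , f-inj , f-adj) =
      Fin.0≢1+n (f-inj _ _ tt tt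
        (trans (only-isolated-misses-edges c₀ c₂ c₃ (edge λ ()) (edge λ ()) (edge λ ()))
               (sym (only-isolated-misses-edges c₁ c₂ c₃ (edge λ ()) (edge λ ()) (edge λ ())))))
      where
      open K₁+CM (K₁+CM-components (f zero) (f∈ zero tt))
      edge : ∀ {i j} → i ≢ j → adj G (f i) (f j) ≡ adj 2K₁+K₂ i j
      edge i≢j = sym (f-adj _ _ tt tt i≢j)
      c₀ : CoComponent G Z (f zero) (f zero)
      c₁ : CoComponent G Z (f zero) (f (suc zero))
      c₂ : CoComponent G Z (f zero) (f (suc (suc zero)))
      c₃ : CoComponent G Z (f zero) (f (suc (suc (suc zero))))
      c₀ = f∈ zero tt , here (f∈ zero tt)
      c₁ = coNeighbour-in (f∈ zero tt) (f∈ (suc zero) tt) (edge λ ())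
      c₂ = coNeighbour-in (f∈ zero tt) (f∈ (suc (suc zero)) tt) (edge λ ())
      c₃ = coNeighbour-in (f∈ zero tt) (f∈ (suc (suc (suc zero))) tt) (edge λ ())

module _ {N : ℕ} {G : Graph N} {Z : VSet N} (Z? : Decidable Z) (P₄-free : ¬ adj G [ Z ]∋ P₄)
         (2K₂-free : ¬ adj G [ Z ]∋ 2K₂) (2K₁+K₂-free : ¬ adj G [ Z ]∋ 2K₁+K₂) where
  open Occurrences (adj G) (adj-sym G) (irrefl G) Z

  -- In the complement of G[Z], a co-universal w is adjacent to every other vertex of its component.
  CoUniversal : Fin N → Set
  CoUniversal w = ∀ {s t} → Z s → Z t → adj G w s ≡ false → adj G s t ≡ false → adj G w t ≡ false

  coUniversal-or-witness : ∀ w → CoUniversal w ⊎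
    ∃₂ λ s t → Z s × Z t × adj G w s ≡ false × adj G s t ≡ false × adj G w t ≡ true
  coUniversal-or-witness w
    with Fin.any? (λ s → Fin.any? (λ t → Z? s ×-dec Z? t ×-dec (adj G w s Bool.≟ false) ×-dec
                                          (adj G s t Bool.≟ false) ×-dec (adj G w t Bool.≟ true)))
  ... | yes witness = inj₂ witness
  ... | no none     = inj₁ λ {s} {t} zs zt ws st → ¬-not λ wt → none (s , t , zs , zt , ws , st , wt)

  forbidden-configuration : ∀ {u v y s t} → Z u → Z v → Z y → Z s → Z t →
    adj G u v ≡ false → adj G v y ≡ false → adj G u y ≡ true →
    adj G v s ≡ false → adj G s t ≡ false → adj G v t ≡ true → ⊥
  forbidden-configuration {u} {v} {y} {s} {t} zu zv zy zs zt uv vy uy vs st vt with adj G u t in ut | adj G y t in yt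
  ... | false | false = 2K₂-free (2K₂-in zu zy zv zt uy uv ut (swap-adj vy) yt vt)
  ... | true  | false = P₄-free (P₄-in zy zu zt zv (swap-adj uy) yt (swap-adj vy) ut uv (swap-adj vt))
  ... | false | true  = P₄-free (P₄-in zu zy zt zv uy ut uv yt (swap-adj vy) (swap-adj vt))
  ... | true  | true with adj G s u in su | adj G s y in sy
  ...   | true  | _     = P₄-free (P₄-in zs zu zt zv su st (swap-adj vs) ut uv (swap-adj vt))
  ...   | false | true  = P₄-free (P₄-in zs zy zt zv sy st (swap-adj vs) yt (swap-adj vy) (swap-adj vt))
  ...   | false | false =
    2K₁+K₂-free (2K₁+K₂-in zs zv zu zy (separated vt st ∘ sym) (swap-adj vs) su sy (swap-adj uv) vy uy)

  coUniversal-beside : ∀ {u s t} → Z u → Z s → Z t →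
                       adj G u s ≡ false → adj G s t ≡ false → adj G u t ≡ true → CoUniversal s
  coUniversal-beside {s = s} zu zs zt us st ut {s′} {t′} zs′ zt′ ss′ s′t′ with adj G s t′ in st′
  ... | false = refl
  ... | true  = ⊥-elim (forbidden-configuration zu zs zt zs′ zt′ us st ut ss′ s′t′ st′)

  coUniversal-coNeighbour : ∀ {u} → Z u → ∃ λ w → Z w × adj G u w ≡ false × CoUniversal w
  coUniversal-coNeighbour {u} zu with coUniversal-or-witness u
  ... | inj₁ u-coUniversal                    = u , zu , irrefl G u , u-coUniversal
  ... | inj₂ (s , t , zs , zt , us , st , ut) = s , zs , us , coUniversal-beside zu zs zt us st ut

  coUniversal-dominates : ∀ {w u v} → CoUniversal w → adj G w u ≡ false → CoReach G Z u v → adj G w v ≡ false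
  coUniversal-dominates w-coUniversal wu (here _)        = wu
  coUniversal-dominates w-coUniversal wu (step r zv _ e) =
    w-coUniversal (coReach-in r) zv (coUniversal-dominates w-coUniversal wu r) e

  coComponent-K₁+CM : ∀ {u} → Z u → IsK1PlusCompleteMultipartite G (CoComponent G Z u)
  coComponent-K₁+CM {u} zu with w , zw , uw , w-coUniversal ← coUniversal-coNeighbour zu =
    w , coNeighbour-in zu zw uw , (λ v (_ , r) _ → dominated r) ,
    completeMultipartite-⊆ G (λ v ((zv , r) , v≢w) → zv , v≢w , dominated r)
      (nonadjacencyTransitive⇒completeMultipartite G S? transitive)
    where
    dominated : ∀ {v} → CoReach G Z u v → adj G w v ≡ false
    dominated = coUniversal-dominates w-coUniversal (swap-adj uw)
    S : VSet N
    S v = Z v × v ≢ w × adj G w v ≡ false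
    S? : Decidable S
    S? v = Z? v ×-dec ¬? (v ≟ w) ×-dec (adj G w v Bool.≟ false)
    transitive : NonadjacencyTransitive G S
    transitive {a} {b} {c} (za , _ , wa) (zb , b≢w , wb) (zc , _ , wc) ab bc with adj G a c in ac
    ... | false = refl
    ... | true  = ⊥-elim (2K₁+K₂-free (2K₁+K₂-in zw zb za zc (b≢w ∘ sym) wb wa wc (swap-adj ab) bc ac))

-- Spiked stars

eqb-refl : ∀ {m} (a : Fin m) → eqb a a ≡ true
eqb-refl a with a ≟ a
... | yes _  = refl
... | no a≢a = ⊥-elim (a≢a refl)

eqb-≢ : ∀ {m} {a b : Fin m} → a ≢ b → eqb a b ≡ false
eqb-≢ {a = a} {b} a≢b with a ≟ b
... | yes a≡b = ⊥-elim (a≢b a≡b)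
... | no _    = refl

eqb⇒≡ : ∀ {m} {a b : Fin m} → eqb a b ≡ true → a ≡ b
eqb⇒≡ {a = a} {b} e with a ≟ b
... | yes a≡b = a≡b

eqb-injective : ∀ {m n} {f : Fin m → Fin n} → (∀ {a b} → f a ≡ f b → a ≡ b) →
                ∀ a b → eqb (f a) (f b) ≡ eqb a b
eqb-injective {f = f} f-inj a b with a ≟ b
... | yes refl = eqb-refl (f a)
... | no a≢b   = eqb-≢ (a≢b ∘ f-inj)

module SpikedStar (k : ℕ) where

  Vertex : Set
  Vertex = Fin (suc k) ⊎ Fin (suc k)

  adjₛ : Vertex → Vertex → Bool
  adjₛ = spAdj (Star k)

  adjₛ-sym : ∀ x y → adjₛ x y ≡ adjₛ y x
  adjₛ-sym = spSym (Star k)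

  adjₛ-irrefl : ∀ x → adjₛ x x ≡ false
  adjₛ-irrefl = spIrr (Star k)

  pattern centre  = inj₁ zero
  pattern centre′ = inj₂ zero
  pattern leaf i  = inj₁ (suc i)
  pattern spike i = inj₂ (suc i)

  base : Vertex → Fin (suc k)
  base = [ id , id ]′

  same-base⇒adjacent : ∀ {x y} → base x ≡ base y → x ≢ y → adjₛ x y ≡ true
  same-base⇒adjacent {inj₁ a} {inj₁ .a} refl x≢y = ⊥-elim (x≢y refl)
  same-base⇒adjacent {inj₁ a} {inj₂ .a} refl _   = eqb-refl a
  same-base⇒adjacent {inj₂ a} {inj₁ .a} refl _   = eqb-refl a
  same-base⇒adjacent {inj₂ a} {inj₂ .a} refl x≢y = ⊥-elim (x≢y refl)

  leaves-apart : ∀ x y {i j} → base x ≡ suc i → base y ≡ suc j → i ≢ j → adjₛ x y ≡ false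
  leaves-apart (inj₁ _) (inj₁ _) refl refl _   = refl
  leaves-apart (inj₁ _) (inj₂ _) refl refl i≢j = eqb-≢ (i≢j ∘ Fin.suc-injective)
  leaves-apart (inj₂ _) (inj₁ _) refl refl i≢j = eqb-≢ (i≢j ∘ Fin.suc-injective)
  leaves-apart (inj₂ _) (inj₂ _) refl refl _   = refl

  centre′-apart : ∀ x {i} → base x ≡ suc i → adjₛ centre′ x ≡ false
  centre′-apart (inj₁ _) refl = refl
  centre′-apart (inj₂ _) refl = refl

  adjacent-unique : ∀ {x y z} → x ≢ centre → y ≢ centre → z ≢ centre →
                    adjₛ x y ≡ true → adjₛ x z ≡ true → y ≡ z
  adjacent-unique {centre} x≢c _ _ _ _ = ⊥-elim (x≢c refl)
  adjacent-unique {leaf _} {centre} _ y≢c _ _ _ = ⊥-elim (y≢c refl)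
  adjacent-unique {leaf _} {inj₂ _} {centre} _ _ z≢c _ _ = ⊥-elim (z≢c refl)
  adjacent-unique {leaf _} {inj₂ _} {inj₂ _} _ _ _ xy xz = cong inj₂ (trans (sym (eqb⇒≡ xy)) (eqb⇒≡ xz))
  adjacent-unique {inj₂ _} {inj₁ _} {inj₁ _} _ _ _ xy xz = cong inj₁ (trans (sym (eqb⇒≡ xy)) (eqb⇒≡ xz))

  transversal-injective : ∀ {s : Fin (suc k) → Vertex} → (∀ i → base (s i) ≡ i) →
                          ∀ i j → s i ≡ s j → i ≡ j
  transversal-injective base-s i j e = trans (sym (base-s i)) (trans (cong base e) (base-s j))

  stable-family-size≤ : ∀ {a} (s : Fin a → Vertex) → (∀ i j → s i ≡ s j → i ≡ j) →
                        (∀ i j → i ≢ j → adjₛ (s i) (s j) ≡ false) → a ≤ suc k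
  stable-family-size≤ s s-inj s-stable = Fin.injective⇒≤ {f = base ∘ s} λ {i} {j} → base-injective i j
    where
    base-injective : ∀ i j → base (s i) ≡ base (s j) → i ≡ j
    base-injective i j same-base with i ≟ j
    ... | yes i≡j = i≡j
    ... | no i≢j  = ⊥-elim (not-¬ (same-base⇒adjacent same-base (i≢j ∘ s-inj i j)) (s-stable i j i≢j))

coordinates : ∀ {n k} (T : Graph n) → Iso T (Spiking (Star k)) → adj T ≅ SpikedStar.adjₛ k
coordinates {k = k} T (f , g , g∘f , f∘g , adj-f) = record
  { to      = splitAt (suc k) ∘ f
  ; from    = g ∘ join (suc k) (suc k)
  ; from∘to = λ u → trans (cong g (Fin.join-splitAt (suc k) (suc k) (f u))) (g∘f u)
  ; to∘from = λ x → trans (cong (splitAt (suc k)) (f∘g _)) (Fin.splitAt-join (suc k) (suc k) x)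
  ; adj-to  = adj-f }

-- The spikes form a stable set of size k + 1, and a stable set meets each pair {a, spike of a} at
-- most once.
leaves-from-alpha : ∀ {n k α} (T : Graph n) → adj T ≅ SpikedStar.adjₛ k → IsAlpha T Full (suc α) → k ≡ α
leaves-from-alpha {k = k} T T≅S ((s , s-inj , _ , s-stable) , maximal) =
  ℕ.≤-antisym (ℕ.≤-pred (maximal (suc k) spikes-stable))
              (ℕ.≤-pred (SpikedStar.stable-family-size≤ k (to T≅S ∘ s)
                           (λ i j → s-inj i j ∘ _≅_.to-injective T≅S)
                           (λ i j i≢j → trans (sym (_≅_.adj-to T≅S (s i) (s j))) (s-stable i j i≢j))))
  where
  spikes-stable : HasStable T Full (suc k)
  spikes-stable = from T≅S ∘ inj₂ ,
                  (λ a b e → inj₂-injective (_≅_.from-injective T≅S e)) ,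
                  (λ _ → tt) ,
                  (λ a b _ → sym (_≅_.adj-from T≅S (inj₂ a) (inj₂ b)))

spikedStar-coordinates : ∀ {n α} (T : Graph n) → IsSpikedStar T → IsAlpha T Full (suc α) →
                         adj T ≅ SpikedStar.adjₛ α
spikedStar-coordinates T (k , iso) alpha with refl ← leaves-from-alpha T (coordinates {k = k} T iso) alpha =
  coordinates T iso

-- Witnessing partitions of a spiked star

module _ {V : Set} {E : V → V → Bool} {Y : V → Set} {N} (G : Graph N) {X : VSet N} where

  clique-⊑ : ∀ {n} (h : V → Fin n) → (∀ {u v} → h u ≡ h v → u ≡ v) → HasClique G X n →
             (∀ {x y} → Y x → Y y → x ≢ y → E x y ≡ true) → E [ Y ]⊑ adj G [ X ]
  clique-⊑ h h-injective (f , f-inj , f∈ , f-adj) Y-clique =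
    f ∘ h , (λ x _ → f∈ (h x)) , (λ x y _ _ → h-injective ∘ f-inj _ _) ,
    (λ x y yx yy x≢y → trans (Y-clique yx yy x≢y) (sym (f-adj _ _ (x≢y ∘ h-injective))))

  nonEdge-not-⊑-clique : E [ Y ]⊑ adj G [ X ] → IsClique G X →
                         ∀ {x y} → Y x → Y y → x ≢ y → E x y ≡ false → ⊥
  nonEdge-not-⊑-clique (f , f∈ , f-inj , f-adj) clique {x} {y} yx yy x≢y xy =
    not-¬ (clique (f x) (f y) (f∈ x yx) (f∈ y yy) (x≢y ∘ f-inj x y yx yy)) (trans (sym (f-adj x y yx yy x≢y)) xy)

  twoNonNeighbours-not-⊑-coMatching : E [ Y ]⊑ adj G [ X ] → IsCoMatching G X →
    ∀ {x y z} → Y x → Y y → Y z → x ≢ y → x ≢ z → y ≢ z → E x y ≡ false → E x z ≡ false → ⊥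
  twoNonNeighbours-not-⊑-coMatching (f , f∈ , f-inj , f-adj) coMatching {x} {y} {z} yx yy yz x≢y x≢z y≢z xy xz =
    y≢z (f-inj y z yy yz (coMatching (f x) (f y) (f z) (f∈ x yx) (f∈ y yy) (f∈ z yz)
                                     (x≢y ∘ f-inj x y yx yy) (x≢z ∘ f-inj x z yx yz)
                                     (trans (sym (f-adj x y yx yy x≢y)) xy) (trans (sym (f-adj x z yx yz x≢z)) xz)))

module _ (k : ℕ) where
  open SpikedStar k

  any-vertex? : {P : Vertex → Set} → Decidable P → Dec (∃ P)
  any-vertex? P? with Fin.any? (P? ∘ inj₁) | Fin.any? (P? ∘ inj₂)
  ... | yes (a , pa) | _            = yes (inj₁ a , pa)
  ... | no _         | yes (a , pa) = yes (inj₂ a , pa)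
  ... | no ¬left     | no ¬right    = no λ { (inj₁ a , pa) → ¬left (a , pa) ; (inj₂ a , pa) → ¬right (a , pa) }

  all-vertex? : {P : Vertex → Set} → Decidable P → Dec (∀ x → P x)
  all-vertex? P? with Fin.all? (P? ∘ inj₁) | Fin.all? (P? ∘ inj₂)
  ... | yes left | yes right = yes λ { (inj₁ a) → left a ; (inj₂ a) → right a }
  ... | no ¬left | _         = no λ all → ¬left (all ∘ inj₁)
  ... | yes _    | no ¬right = no λ all → ¬right (all ∘ inj₂)

  three-nonCentre-not-⊑-coMatching : ∀ {Y : Vertex → Set} {N} (G : Graph N) {X : VSet N} →
    adjₛ [ Y ]⊑ adj G [ X ] → IsCoMatching G X →
    ∀ {x y z} → Y x → Y y → Y z → x ≢ y → x ≢ z → y ≢ z →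
    x ≢ centre → y ≢ centre → z ≢ centre → ⊥
  three-nonCentre-not-⊑-coMatching G emb coMatching {x} {y} {z} yx yy yz x≢y x≢z y≢z x≢c y≢c z≢c
    with adjₛ x y in xy | adjₛ x z in xz
  ... | false | false = twoNonNeighbours-not-⊑-coMatching G emb coMatching yx yy yz x≢y x≢z y≢z xy xz
  ... | true  | _     = twoNonNeighbours-not-⊑-coMatching G emb coMatching yz yx yy (x≢z ∘ sym) (y≢z ∘ sym) x≢y
      (¬-not λ zx → y≢z (adjacent-unique x≢c y≢c z≢c xy (trans (adjₛ-sym x z) zx)))
      (¬-not λ zy → x≢z (adjacent-unique y≢c x≢c z≢c (trans (adjₛ-sym y x) xy) (trans (adjₛ-sym y z) zy)))
  ... | false | true  = twoNonNeighbours-not-⊑-coMatching G emb coMatching yy yx yz (x≢y ∘ sym) y≢z x≢z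
      (trans (adjₛ-sym y x) xy)
      (¬-not λ yz → x≢y (adjacent-unique z≢c x≢c y≢c (trans (adjₛ-sym z x) xz) (trans (adjₛ-sym z y) yz)))

  private
    spikeOrLeaf : Fin (suc k) ⊎ Fin k → Vertex
    spikeOrLeaf (inj₁ a) = inj₂ a
    spikeOrLeaf (inj₂ i) = leaf i

    spikeOrLeaf-injective : ∀ {s t} → spikeOrLeaf s ≡ spikeOrLeaf t → s ≡ t
    spikeOrLeaf-injective {inj₁ _} {inj₁ _} refl = refl
    spikeOrLeaf-injective {inj₂ _} {inj₂ _} refl = refl

    spikeOrLeaf-≢centre : ∀ s → spikeOrLeaf s ≢ centre
    spikeOrLeaf-≢centre (inj₁ _) ()
    spikeOrLeaf-≢centre (inj₂ _) ()

    nonCentre : Fin (suc k + k) → Vertex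
    nonCentre = spikeOrLeaf ∘ splitAt (suc k)

    nonCentre-≢ : ∀ {s t} → s ≢ t → nonCentre s ≢ nonCentre t
    nonCentre-≢ s≢t = s≢t ∘ splitAt-injective (suc k) k ∘ spikeOrLeaf-injective

  coMatchings⇒witnessing : ∀ {N} (G : Graph N) (p : Fin N → Fin k) →
                           (∀ i → IsCoMatching G (Part p i)) → WitnessingFor adjₛ G p
  coMatchings⇒witnessing G p coMatching q
    with s , i , j , s<i , i<j , qs≡qi , qi≡qj ← pigeonhole₃ (q ∘ nonCentre) (ℕ.n<1+n (k + k)) =
    q (nonCentre i) , λ emb →
      three-nonCentre-not-⊑-coMatching G emb (coMatching _) qs≡qi refl (sym qi≡qj)
        (nonCentre-≢ (Fin.<⇒≢ s<i)) (nonCentre-≢ (Fin.<⇒≢ (Fin.<-trans s<i i<j))) (nonCentre-≢ (Fin.<⇒≢ i<j))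
        (spikeOrLeaf-≢centre _) (spikeOrLeaf-≢centre _) (spikeOrLeaf-≢centre _)

module _ (m : ℕ) where
  open SpikedStar (suc m)

  module _ (q : Vertex → Fin (suc m))
           (cliqueParts : ∀ r {x y} → q x ≡ suc r → q y ≡ suc r → x ≢ y → adjₛ x y ≡ true) where
    open Occurrences adjₛ adjₛ-sym adjₛ-irrefl (λ v → q v ≡ zero)

    stable-twice-in-zero : (s : Fin (suc (suc m)) → Vertex) → (∀ a b → s a ≡ s b → a ≡ b) →
                           (∀ a b → a ≢ b → adjₛ (s a) (s b) ≡ false) →
                           ∃₂ λ a b → a ≢ b × q (s a) ≡ zero × q (s b) ≡ zero
    stable-twice-in-zero s s-inj s-stable with a , b , a<b , same ← Fin.pigeonhole (ℕ.n<1+n (suc m)) (q ∘ s)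
                                          with q (s a) in qa
    ... | zero  = a , b , Fin.<⇒≢ a<b , qa , sym same
    ... | suc r =
      ⊥-elim (not-¬ (cliqueParts r qa (sym same) (Fin.<⇒≢ a<b ∘ s-inj a b)) (s-stable a b (Fin.<⇒≢ a<b)))

    private
      -- the vertex of leaf pair i outside part zero, if the pair is not contained in it
      outside : Fin (suc m) → Vertex
      outside i with q (spike i) ≟ zero
      ... | yes _ = leaf i
      ... | no _  = spike i

      outside-base : ∀ i → base (outside i) ≡ suc i
      outside-base i with q (spike i) ≟ zero
      ... | yes _ = refl
      ... | no _  = refl

      outside-in-zero : ∀ i → q (outside i) ≡ zero → q (leaf i) ≡ zero × q (spike i) ≡ zero
      outside-in-zero i q-outside with q (spike i) ≟ zero
      ... | yes q-spike = q-outside , q-spike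
      ... | no ¬q-spike = ⊥-elim (¬q-spike q-outside)

      centre′-and-outsides : Fin (suc (suc m)) → Vertex
      centre′-and-outsides zero    = centre′
      centre′-and-outsides (suc i) = outside i

      centre′-and-outsides-stable : ∀ a b → a ≢ b →
                                    adjₛ (centre′-and-outsides a) (centre′-and-outsides b) ≡ false
      centre′-and-outsides-stable zero    zero    a≢b = ⊥-elim (a≢b refl)
      centre′-and-outsides-stable zero    (suc j) _   = centre′-apart (outside j) (outside-base j)
      centre′-and-outsides-stable (suc i) zero    _   =
        trans (adjₛ-sym (outside i) centre′) (centre′-apart (outside i) (outside-base i))
      centre′-and-outsides-stable (suc i) (suc j) i≢j =
        leaves-apart (outside i) (outside j) (outside-base i) (outside-base j) (i≢j ∘ cong suc)

      centre-and-spikes : Fin (suc (suc m)) → Vertex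
      centre-and-spikes zero    = centre
      centre-and-spikes (suc i) = spike i

      centre-and-spikes-stable : ∀ a b → a ≢ b → adjₛ (centre-and-spikes a) (centre-and-spikes b) ≡ false
      centre-and-spikes-stable zero    zero    a≢b = ⊥-elim (a≢b refl)
      centre-and-spikes-stable zero    (suc j) _   = refl
      centre-and-spikes-stable (suc i) zero    _   = refl
      centre-and-spikes-stable (suc i) (suc j) _   = refl

      two-full-pairs : ∀ {i j} → i ≢ j → q (outside i) ≡ zero → q (outside j) ≡ zero →
                       adjₛ [ (λ v → q v ≡ zero) ]∋ 2K₂
      two-full-pairs {i} {j} i≢j qi qj =
        2K₂-in (proj₁ (outside-in-zero i qi)) (proj₂ (outside-in-zero i qi))
               (proj₁ (outside-in-zero j qj)) (proj₂ (outside-in-zero j qj))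
               (eqb-refl (suc i)) refl (eqb-≢ (i≢j ∘ Fin.suc-injective)) (eqb-≢ (i≢j ∘ Fin.suc-injective)) refl
               (eqb-refl (suc j))

      spike-beside-full-pair : ∀ {a j} → a ≢ j → q (spike a) ≡ zero →
                               q centre′ ≡ zero → q (leaf j) ≡ zero → q (spike j) ≡ zero →
                               adjₛ [ (λ v → q v ≡ zero) ]∋ 2K₁+K₂
      spike-beside-full-pair {a} {j} a≢j q-spike-a q-centre′ q-leaf q-spike =
        2K₁+K₂-in q-spike-a q-centre′ q-leaf q-spike (λ ())
                  refl (eqb-≢ (a≢j ∘ Fin.suc-injective)) refl refl refl (eqb-refl (suc j))

      centres-beside-full-pair : ∀ {j} → q centre′ ≡ zero → q (leaf j) ≡ zero → q (spike j) ≡ zero →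
                                 adjₛ [ (λ v → q v ≡ zero) ]∋ P₄ ⊎ adjₛ [ (λ v → q v ≡ zero) ]∋ 2K₁+K₂
      centres-beside-full-pair {j} q-centre′ q-leaf q-spike with q centre ≟ zero
      ... | yes q-centre = inj₁ (P₄-in q-centre′ q-centre q-leaf q-spike refl refl refl refl refl (eqb-refl (suc j)))
      ... | no ¬q-centre
        with stable-twice-in-zero centre-and-spikes (transversal-injective λ { zero → refl ; (suc _) → refl })
                                  centre-and-spikes-stable
      ...   | zero  , _     , _   , q-c , _   = ⊥-elim (¬q-centre q-c)
      ...   | suc _ , zero  , _   , _   , q-c = ⊥-elim (¬q-centre q-c)
      ...   | suc a , suc b , a≢b , qa  , qb with a ≟ j
      ...     | no a≢j   = inj₂ (spike-beside-full-pair a≢j qa q-centre′ q-leaf q-spike)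
      ...     | yes refl = inj₂ (spike-beside-full-pair (a≢b ∘ cong suc ∘ sym) qb q-centre′ q-leaf q-spike)

    part-zero-forbidden : adjₛ [ (λ v → q v ≡ zero) ]∋ P₄ ⊎ adjₛ [ (λ v → q v ≡ zero) ]∋ 2K₂ ⊎
                          adjₛ [ (λ v → q v ≡ zero) ]∋ 2K₁+K₂
    part-zero-forbidden
      with stable-twice-in-zero centre′-and-outsides (transversal-injective λ { zero → refl ; (suc i) → outside-base i })
                                centre′-and-outsides-stable
    ... | zero  , zero  , a≢b , _   , _   = ⊥-elim (a≢b refl)
    ... | suc i , suc j , i≢j , qi  , qj  = inj₂ (inj₁ (two-full-pairs (i≢j ∘ cong suc) qi qj))
    ... | zero  , suc j , _   , q-c , qj  = Sum.map₂ inj₂ (uncurry (centres-beside-full-pair q-c) (outside-in-zero j qj))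
    ... | suc j , zero  , _   , qj  , q-c = Sum.map₂ inj₂ (uncurry (centres-beside-full-pair q-c) (outside-in-zero j qj))

  cliques⇒witnessing : ∀ {N} (G : Graph N) (p : Fin N → Fin (suc m)) →
                       (∀ j → j ≢ zero → IsClique G (Part p j)) →
                       ¬ adj G [ Part p zero ]∋ P₄ → ¬ adj G [ Part p zero ]∋ 2K₂ →
                       ¬ adj G [ Part p zero ]∋ 2K₁+K₂ → WitnessingFor adjₛ G p
  cliques⇒witnessing G p cliques P₄-free 2K₂-free 2K₁+K₂-free q
    with Fin.any? (λ r → any-vertex? (suc m) (λ x → any-vertex? (suc m) (λ y →
           (q x ≟ suc r) ×-dec (q y ≟ suc r) ×-dec ¬? (≡-dec _≟_ _≟_ x y) ×-dec (adjₛ x y Bool.≟ false))))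
  ... | yes (r , x , y , qx , qy , x≢y , xy) =
    suc r , λ emb → nonEdge-not-⊑-clique G emb (cliques (suc r) λ ()) qx qy x≢y xy
  ... | no no-nonEdge = zero , λ emb →
    [ P₄-free ∘ transfer {H = P₄} emb ,
      [ 2K₂-free ∘ transfer {H = 2K₂} emb , 2K₁+K₂-free ∘ transfer {H = 2K₁+K₂} emb ]′ ]′
      (part-zero-forbidden q (λ r {x} {y} qx qy x≢y → ¬-not λ xy → no-nonEdge (r , x , y , qx , qy , x≢y , xy)))
    where
    transfer : ∀ {r} {H : Graph r} → adjₛ [ (λ v → q v ≡ zero) ]⊑ adj G [ Part p zero ] →
               adjₛ [ (λ v → q v ≡ zero) ]∋ H → adj G [ Part p zero ]∋ H
    transfer emb occurrence = ⊑-trans {H = adj G} {X = Part p zero} occurrence emb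

-- Certifying partitions: splitting a spiked P₃ between two parts

AllCoMatchings : ∀ {N k} → Graph N → (Fin N → Fin k) → Set
AllCoMatchings G p = ∀ i → IsCoMatching G (Part p i)

CliquesBesideK₁+CM : ∀ {N k} → Graph N → (Fin N → Fin (suc k)) → Set
CliquesBesideK₁+CM G p = (∀ j → j ≢ zero → IsClique G (Part p j)) ×
                         (∀ u → Part p zero u → IsK1PlusCompleteMultipartite G (CoComponent G (Part p zero) u))

module Template (m₁ : ℕ) where
  open SpikedStar (suc (suc m₁))
  module SpikedP₃ = SpikedStar 2

  embed : SpikedP₃.Vertex → Vertex
  embed = Sum.map (_↑ˡ m₁) (_↑ˡ m₁)

  embed-adj : ∀ s t → adjₛ (embed s) (embed t) ≡ SpikedP₃.adjₛ s t
  embed-adj (inj₁ zero)    (inj₁ zero)    = refl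
  embed-adj (inj₁ zero)    (inj₁ (suc _)) = refl
  embed-adj (inj₁ (suc _)) (inj₁ zero)    = refl
  embed-adj (inj₁ (suc _)) (inj₁ (suc _)) = refl
  embed-adj (inj₁ a)       (inj₂ b)       = eqb-injective (Fin.↑ˡ-injective m₁ _ _) a b
  embed-adj (inj₂ a)       (inj₁ b)       = eqb-injective (Fin.↑ˡ-injective m₁ _ _) a b
  embed-adj (inj₂ _)       (inj₂ _)       = refl

  position : Vertex → SpikedP₃.Vertex ⊎ Fin m₁
  position (inj₁ a) with splitAt 3 a
  ... | inj₁ s = inj₁ (inj₁ s)
  ... | inj₂ t = inj₂ t
  position (inj₂ a) with splitAt 3 a
  ... | inj₁ s = inj₁ (inj₂ s)
  ... | inj₂ t = inj₂ t

  position-template : ∀ x {s} → position x ≡ inj₁ s → x ≡ embed s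
  position-template (inj₁ a) e with splitAt 3 a in split-a
  position-template (inj₁ a) refl | inj₁ s = cong inj₁ (sym (Fin.splitAt⁻¹-↑ˡ split-a))
  position-template (inj₂ a) e with splitAt 3 a in split-a
  position-template (inj₂ a) refl | inj₁ s = cong inj₂ (sym (Fin.splitAt⁻¹-↑ˡ split-a))

  position-extra : ∀ x {t} → position x ≡ inj₂ t → base x ≡ 3 ↑ʳ t
  position-extra (inj₁ a) e with splitAt 3 a in split-a
  position-extra (inj₁ a) refl | inj₂ t = sym (Fin.splitAt⁻¹-↑ʳ split-a)
  position-extra (inj₂ a) e with splitAt 3 a in split-a
  position-extra (inj₂ a) refl | inj₂ t = sym (Fin.splitAt⁻¹-↑ʳ split-a)

  template-part-⊑ : ∀ {Y : Vertex → Set} {Y₃ : SpikedP₃.Vertex → Set} →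
                    (∀ {x} → Y x → ∃ λ s → position x ≡ inj₁ s × Y₃ s) →
                    adjₛ [ Y ]⊑ SpikedP₃.adjₛ [ Y₃ ]
  template-part-⊑ {Y} {Y₃} located = retract , retract-∈ , retract-injective , retract-adj
    where
    retract : Vertex → SpikedP₃.Vertex
    retract x = [ id , const SpikedP₃.centre ]′ (position x)
    retract-located : ∀ {x} → Y x → position x ≡ inj₁ (retract x)
    retract-located yx with _ , pos , _ ← located yx rewrite pos = refl
    retract-∈ : ∀ x → Y x → Y₃ (retract x)
    retract-∈ x yx with _ , pos , y₃s ← located yx rewrite pos = y₃s
    retract-injective : ∀ x y → Y x → Y y → retract x ≡ retract y → x ≡ y
    retract-injective x y yx yy e =
      trans (position-template x (retract-located yx)) (trans (cong embed e) (sym (position-template y (retract-located yy))))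
    retract-adj : ∀ x y → Y x → Y y → x ≢ y → adjₛ x y ≡ SpikedP₃.adjₛ (retract x) (retract y)
    retract-adj x y yx yy _ =
      trans (cong₂ adjₛ (position-template x (retract-located yx)) (position-template y (retract-located yy)))
            (embed-adj (retract x) (retract y))

  -- The spiked P₃ goes to part zero or part r₀ + 1 as σ says, the t-th further leaf pair to the
  -- t-th of the remaining parts.
  spread : Fin (suc m₁) → (SpikedP₃.Vertex → Bool) → Vertex → Fin (suc (suc m₁))
  spread r₀ σ x with position x
  ... | inj₁ s = if σ s then zero else suc r₀
  ... | inj₂ t = suc (punchIn r₀ t)

  module _ {r₀ : Fin (suc m₁)} {σ : SpikedP₃.Vertex → Bool} where

    spread-zero : ∀ {x} → spread r₀ σ x ≡ zero → ∃ λ s → position x ≡ inj₁ s × σ s ≡ true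
    spread-zero {x} e with position x in pos
    ... | inj₁ s with σ s in σs
    ...   | true = s , refl , σs

    spread-r₀ : ∀ {x} → spread r₀ σ x ≡ suc r₀ → ∃ λ s → position x ≡ inj₁ s × σ s ≡ false
    spread-r₀ {x} e with position x in pos
    ... | inj₁ s with σ s in σs
    ...   | false = s , refl , σs
    spread-r₀ {x} e | inj₂ t = ⊥-elim (Fin.punchInᵢ≢i r₀ t (Fin.suc-injective e))

    spread-elsewhere : ∀ {x r} → spread r₀ σ x ≡ suc r → r ≢ r₀ →
                       ∃ λ t → position x ≡ inj₂ t × punchIn r₀ t ≡ r
    spread-elsewhere {x} e r≢r₀ with position x in pos
    ... | inj₁ s with σ s
    ...   | false = ⊥-elim (r≢r₀ (sym (Fin.suc-injective e)))
    spread-elsewhere {x} e r≢r₀ | inj₂ t = t , refl , Fin.suc-injective e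

    elsewhere-clique : ∀ {r x y} → r ≢ r₀ → spread r₀ σ x ≡ suc r → spread r₀ σ y ≡ suc r →
                       x ≢ y → adjₛ x y ≡ true
    elsewhere-clique {x = x} {y} r≢r₀ ex ey x≢y
      with t , pos-x , t↦r ← spread-elsewhere {x} ex r≢r₀ | t′ , pos-y , t′↦r ← spread-elsewhere {y} ey r≢r₀
      with refl ← Fin.punchIn-injective r₀ t t′ (trans t↦r (sym t′↦r)) =
      same-base⇒adjacent (trans (position-extra x pos-x) (sym (position-extra y pos-y))) x≢y

  Faithful : ∀ {r} → (SpikedP₃.Vertex → Set) → Graph r → (SpikedP₃.Vertex → Fin r) → Set
  Faithful Y H f = ∀ u v → Y u → Y v → u ≢ v → f u ≢ f v × SpikedP₃.adjₛ u v ≡ adj H (f u) (f v)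

  faithful? : ∀ {r} {Y : SpikedP₃.Vertex → Set} → Decidable Y → (H : Graph r) (f : SpikedP₃.Vertex → Fin r) →
              Dec (Faithful Y H f)
  faithful? Y? H f = all-vertex? 2 λ u → all-vertex? 2 λ v →
    Y? u →-dec (Y? v →-dec (¬? (≡-dec _≟_ _≟_ u v) →-dec
      (¬? (f u ≟ f v) ×-dec (SpikedP₃.adjₛ u v Bool.≟ adj H (f u) (f v)))))

  faithful⇒⊑ : ∀ {r} {Y : SpikedP₃.Vertex → Set} {H : Graph r} {f} → Faithful Y H f →
               SpikedP₃.adjₛ [ Y ]⊑ adj H [ Full ]
  faithful⇒⊑ {Y = Y} {f = f} faithful =
    f , (λ _ _ → tt) , injective , (λ u v yu yv u≢v → proj₂ (faithful u v yu yv u≢v))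
    where
    injective : ∀ u v → Y u → Y v → f u ≡ f v → u ≡ v
    injective u v yu yv fu≡fv with ≡-dec _≟_ _≟_ u v
    ... | yes u≡v = u≡v
    ... | no u≢v  = ⊥-elim (proj₁ (faithful u v yu yv u≢v) fu≡fv)

  isLeft : ∀ {a b} → Fin a ⊎ Fin b → Bool
  isLeft = [ const true , const false ]′

  record Split {a b} (H₀ : Graph (suc a)) (H₁ : Graph (suc b)) : Set where
    field
      τ         : SpikedP₃.Vertex → Fin (suc a) ⊎ Fin (suc b)
      faithful₀ : Faithful (λ s → isLeft (τ s) ≡ true)  H₀ ([ id , const zero ]′ ∘ τ)
      faithful₁ : Faithful (λ s → isLeft (τ s) ≡ false) H₁ ([ const zero , id ]′ ∘ τ)

  -- Both implicit arguments are discharged by evaluating the decision procedure on the table τ.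
  split : ∀ {a b} {H₀ : Graph (suc a)} {H₁ : Graph (suc b)} (τ : SpikedP₃.Vertex → Fin (suc a) ⊎ Fin (suc b)) →
          {True (faithful? (λ s → isLeft (τ s) Bool.≟ true) H₀ ([ id , const zero ]′ ∘ τ))} →
          {True (faithful? (λ s → isLeft (τ s) Bool.≟ false) H₁ ([ const zero , id ]′ ∘ τ))} → Split H₀ H₁
  split τ {faithful₀} {faithful₁} =
    record { τ = τ ; faithful₀ = toWitness faithful₀ ; faithful₁ = toWitness faithful₁ }

  open SpikedP₃ using (centre; centre′; leaf; spike)

  K₁+K₂∣P₃ : Split K₁+K₂ P₃
  K₁+K₂∣P₃ = split τ
    where
    τ : SpikedP₃.Vertex → Fin 3 ⊎ Fin 3
    τ (spike zero)       = inj₁ (# 0)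
    τ (leaf (suc zero))  = inj₁ (# 1)
    τ (spike (suc zero)) = inj₁ (# 2)
    τ (leaf zero)        = inj₂ (# 0)
    τ centre             = inj₂ (# 1)
    τ centre′            = inj₂ (# 2)

  K₁+K₂∣K₁+K₂ : Split K₁+K₂ K₁+K₂
  K₁+K₂∣K₁+K₂ = split τ
    where
    τ : SpikedP₃.Vertex → Fin 3 ⊎ Fin 3
    τ (leaf zero)        = inj₁ (# 0)
    τ (leaf (suc zero))  = inj₁ (# 1)
    τ (spike (suc zero)) = inj₁ (# 2)
    τ (spike zero)       = inj₂ (# 0)
    τ centre             = inj₂ (# 1)
    τ centre′            = inj₂ (# 2)

  3K₁∣P₃ : Split 3K₁ P₃
  3K₁∣P₃ = split τ
    where
    τ : SpikedP₃.Vertex → Fin 3 ⊎ Fin 3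
    τ (spike zero)       = inj₁ (# 0)
    τ centre′            = inj₁ (# 1)
    τ (spike (suc zero)) = inj₁ (# 2)
    τ (leaf zero)        = inj₂ (# 0)
    τ centre             = inj₂ (# 1)
    τ (leaf (suc zero))  = inj₂ (# 2)

  3K₁∣K₁+K₂ : Split 3K₁ K₁+K₂
  3K₁∣K₁+K₂ = split τ
    where
    τ : SpikedP₃.Vertex → Fin 3 ⊎ Fin 3
    τ (leaf zero)        = inj₁ (# 0)
    τ (spike (suc zero)) = inj₁ (# 1)
    τ centre′            = inj₁ (# 2)
    τ (spike zero)       = inj₂ (# 0)
    τ centre             = inj₂ (# 1)
    τ (leaf (suc zero))  = inj₂ (# 2)

  P₃∣3K₁ : Split P₃ 3K₁
  P₃∣3K₁ = split (Sum.swap ∘ Split.τ 3K₁∣P₃)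

  P₃∣K₁+K₂ : Split P₃ K₁+K₂
  P₃∣K₁+K₂ = split (Sum.swap ∘ Split.τ K₁+K₂∣P₃)

  2K₂∣K₂ : Split 2K₂ K₂
  2K₂∣K₂ = split τ
    where
    τ : SpikedP₃.Vertex → Fin 4 ⊎ Fin 2
    τ (leaf zero)        = inj₁ (# 0)
    τ (spike zero)       = inj₁ (# 1)
    τ (leaf (suc zero))  = inj₁ (# 2)
    τ (spike (suc zero)) = inj₁ (# 3)
    τ centre             = inj₂ (# 0)
    τ centre′            = inj₂ (# 1)

  2K₁+K₂∣K₂ : Split 2K₁+K₂ K₂
  2K₁+K₂∣K₂ = split τ
    where
    τ : SpikedP₃.Vertex → Fin 4 ⊎ Fin 2
    τ centre′            = inj₁ (# 0)
    τ (spike zero)       = inj₁ (# 1)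
    τ (leaf (suc zero))  = inj₁ (# 2)
    τ (spike (suc zero)) = inj₁ (# 3)
    τ centre             = inj₂ (# 0)
    τ (leaf zero)        = inj₂ (# 1)

  module _ {n N} (G : Graph N) (p : Fin N → Fin (suc (suc m₁)))
           (h : Vertex → Fin n) (h-injective : ∀ {x y} → h x ≡ h y → x ≡ y)
           (witnessing : WitnessingFor adjₛ G p) (cliques : ∀ j → j ≢ zero → HasClique G (Part p j) n) where

    template-split-refutes : ∀ (r₀ : Fin (suc m₁)) (σ : SpikedP₃.Vertex → Bool) →
                             SpikedP₃.adjₛ [ (λ s → σ s ≡ true) ]⊑ adj G [ Part p zero ] →
                             SpikedP₃.adjₛ [ (λ s → σ s ≡ false) ]⊑ adj G [ Part p (suc r₀) ] → ⊥
    template-split-refutes r₀ σ half₀ half₁ with witnessing (spread r₀ σ)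
    ... | zero , no-embedding =
      no-embedding (⊑-trans {H = adj G} {X = Part p zero} (template-part-⊑ (λ {x} → spread-zero {x = x})) half₀)
    ... | suc r , no-embedding with r ≟ r₀
    ...   | yes refl =
      no-embedding (⊑-trans {H = adj G} {X = Part p (suc r₀)} (template-part-⊑ (λ {x} → spread-r₀ {x = x})) half₁)
    ...   | no r≢r₀  =
      no-embedding (clique-⊑ G {X = Part p (suc r)} h h-injective (cliques (suc r) λ ()) (elsewhere-clique r≢r₀))

    split-refutes : ∀ {a b} {H₀ : Graph (suc a)} {H₁ : Graph (suc b)} → Split H₀ H₁ → ∀ r₀ →
                    adj G [ Part p zero ]∋ H₀ → adj G [ Part p (suc r₀) ]∋ H₁ → ⊥
    split-refutes {H₀ = H₀} {H₁} s r₀ occurrence₀ occurrence₁ =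
      template-split-refutes r₀ (isLeft ∘ τ)
        (⊑-trans {H = adj G} {X = Part p zero} (faithful⇒⊑ {H = H₀} faithful₀) occurrence₀)
        (⊑-trans {H = adj G} {X = Part p (suc r₀)} (faithful⇒⊑ {H = H₁} faithful₁) occurrence₁)
      where open Split s

    module _ (2<n : 2 < n) (alpha≥ : ∀ j → j ≢ zero → AlphaGE G (Part p zero) (Part p j))
             (large₀ : HasClique G (Part p zero) n ⊎ HasStable G (Part p zero) n) where

      coMatchings-beside-nonEdge : ∀ r₀ → NonEdge G (Part p (suc r₀)) →
                                   IsCoMatching G (Part p zero) × IsCoMatching G (Part p (suc r₀))
      coMatchings-beside-nonEdge r₀ nonEdge = X₀-coMatching , Xⱼ-coMatching
        where
        Xⱼ-pattern : adj G [ Part p (suc r₀) ]∋ P₃ ⊎ adj G [ Part p (suc r₀) ]∋ K₁+K₂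
        Xⱼ-pattern = P₃-or-K₁+K₂ G {Part p (suc r₀)} 2<n (cliques (suc r₀) λ ()) nonEdge
        X₀-coMatching : IsCoMatching G (Part p zero)
        X₀-coMatching = coMatching-if-free G
          (λ k₁+k₂ → [ split-refutes K₁+K₂∣P₃ r₀ k₁+k₂ , split-refutes K₁+K₂∣K₁+K₂ r₀ k₁+k₂ ]′
                       Xⱼ-pattern)
          (λ 3k₁ → [ split-refutes 3K₁∣P₃ r₀ 3k₁ , split-refutes 3K₁∣K₁+K₂ r₀ 3k₁ ]′ Xⱼ-pattern)
        P₃-beside-clique : HasClique G (Part p zero) n → adj G [ Part p zero ]∋ P₃
        P₃-beside-clique clique with nonEdge? G (λ v → p v ≟ zero)
        ... | yes nonEdge₀   = coMatching-P₃ G 2<n clique X₀-coMatching nonEdge₀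
        ... | no no-nonEdge₀ = ⊥-elim (clique⇒no-nonEdge G Xⱼ-clique nonEdge)
          where
          Xⱼ-clique : IsClique G (Part p (suc r₀))
          Xⱼ-clique = alphaGE-clique G (alpha≥ (suc r₀) λ ()) (no-nonEdge⇒clique G no-nonEdge₀)
                        (proj₂ (clique-vertex G {Part p zero} (ℕ.<-trans (s≤s z≤n) 2<n) clique))
        X₀-P₃ : adj G [ Part p zero ]∋ P₃
        X₀-P₃ = [ P₃-beside-clique , ⊥-elim ∘ coMatching-no-stable G X₀-coMatching 2<n ]′ large₀
        Xⱼ-coMatching : IsCoMatching G (Part p (suc r₀))
        Xⱼ-coMatching =
          coMatching-if-free G (split-refutes P₃∣K₁+K₂ r₀ X₀-P₃) (split-refutes P₃∣3K₁ r₀ X₀-P₃)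

      certifying⇒structure : P4Free G (Part p zero) → AllCoMatchings G p ⊎ CliquesBesideK₁+CM G p
      certifying⇒structure P4-free₀ with Fin.any? (λ r → nonEdge? G (λ v → p v ≟ suc r))
      ... | yes (r₀ , nonEdge) = inj₁ coMatchings
        where
        coMatchings : AllCoMatchings G p
        coMatchings zero    = proj₁ (coMatchings-beside-nonEdge r₀ nonEdge)
        coMatchings (suc r) with nonEdge? G (λ v → p v ≟ suc r)
        ... | yes nonEdgeᵣ   = proj₂ (coMatchings-beside-nonEdge r nonEdgeᵣ)
        ... | no no-nonEdgeᵣ = clique⇒coMatching G (no-nonEdge⇒clique G no-nonEdgeᵣ)
      ... | no no-nonEdge =
        inj₂ (nonzero-cliques , λ u → coComponent-K₁+CM (λ v → p v ≟ zero) (P4Free⇒P₄-free G P4-free₀)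
                                        (λ occurrence → split-refutes 2K₂∣K₂ zero occurrence K₂-in-X₁)
                                        (λ occurrence → split-refutes 2K₁+K₂∣K₂ zero occurrence K₂-in-X₁))
        where
        nonzero-cliques : ∀ j → j ≢ zero → IsClique G (Part p j)
        nonzero-cliques zero    0≢0 = ⊥-elim (0≢0 refl)
        nonzero-cliques (suc r) _   = no-nonEdge⇒clique G (λ nonEdge → no-nonEdge (r , nonEdge))
        K₂-in-X₁ : adj G [ Part p (suc zero) ]∋ K₂
        K₂-in-X₁ = clique-K₂ G {Part p (suc zero)} (ℕ.<-trans (ℕ.n<1+n 1) 2<n) (cliques (suc zero) λ ())

module _ {n N m} (T : Graph n) (G : Graph N) (T≅S : adj T ≅ SpikedStar.adjₛ (suc m))
         (p : Fin N → Fin (suc m)) (2<n : 2 < n) where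

  private
    large-clique : ∀ {X : VSet N} → ¬ HasStable G X n → HasClique G X n ⊎ HasStable G X n → HasClique G X n
    large-clique no-stable = [ id , ⊥-elim ∘ no-stable ]′

  structure⇒certifying : Interesting T G p → AllCoMatchings G p ⊎ CliquesBesideK₁+CM G p → Certifying T G p
  structure⇒certifying (alpha≥ , large) (inj₁ coMatchings) =
    ≅-witnessing G p T≅S (coMatchings⇒witnessing (suc m) G p coMatchings) ,
    alpha≥ ,
    ((λ j _ → large-clique {Part p j} (coMatching-no-stable G (coMatchings j) 2<n) (large j)) , large zero) ,
    (λ i → coMatching⇒P4Free G (coMatchings i))
  structure⇒certifying (alpha≥ , large) (inj₂ (cliques , K₁+CM)) =
    ≅-witnessing G p T≅S (cliques⇒witnessing m G p cliques (K₁+CM⇒P₄-free K₁+CM) (K₁+CM⇒2K₂-free K₁+CM)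
                                                           (K₁+CM⇒2K₁+K₂-free K₁+CM)) ,
    alpha≥ ,
    ((λ j j≢0 → large-clique {Part p j} (clique-no-stable G (cliques j j≢0) (ℕ.<-trans (ℕ.n<1+n 1) 2<n)) (large j)) , large zero) ,
    P4-free
    where
    P4-free : ∀ i → P4Free G (Part p i)
    P4-free zero    = P₄-free⇒P4Free G (K₁+CM⇒P₄-free K₁+CM)
    P4-free (suc r) = clique⇒P4Free G (cliques (suc r) λ ())

mainTheorem15 : ∀ {n N} (T : Graph n) (G : Graph N) (m : ℕ) →
    IsSpikedStar T → IsAlpha T Full (suc (suc m)) → 1 ≤ m →
    (p : Fin N → Fin (suc m)) → Interesting T G p →
    Certifying T G p ⇔
      ((∀ i → IsCoMatching G (Part p i)) ⊎
       ((∀ j → j ≢ zero → IsClique G (Part p j)) ×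
        (∀ u → Part p zero u →
          IsK1PlusCompleteMultipartite G (CoComponent G (Part p zero) u))))
mainTheorem15 {n} T G (suc m₁) spiked alpha (s≤s z≤n) p interesting =
  mk⇔ (λ (witnessing , alpha≥ , (cliques , large₀) , P4-free) →
         Template.certifying⇒structure m₁ G p (from T≅S) (_≅_.from-injective T≅S)
           (≅-witnessing G p (≅-sym T≅S) witnessing) cliques 2<n alpha≥ large₀ (P4-free zero))
      (structure⇒certifying T G T≅S p 2<n interesting)
  where
  T≅S : adj T ≅ SpikedStar.adjₛ (suc (suc m₁))
  T≅S = spikedStar-coordinates T spiked alpha
  2<n : 2 < n
  2<n = ℕ.≤-trans (s≤s (s≤s (s≤s z≤n))) (stable-size≤ T {Full} (proj₁ alpha))
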